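{- Let $\ell\ge 6$. Start with the wheel $C_6\vee K_1$ with rim cycle $(w_1,\dots,w_6,w_1)$ and hub $w_0$ adjacent to $w_1,\dots,w_6$. Add a path $(v_1,\dots,v_{\ell-3})$ on new vertices; join $w_1$ to each of $v_1,\dots,v_{\ell-4}$; join $w_2$ to $v_1$; join $w_4$ to $v_{\ell-3}$; join $w_5$ to $v_{\ell-4}$ and $v_{\ell-3}$; join $v_{\ell-5}$ to $v_{\ell-3}$. Let $\overline{G}$ be the resulting graph and $G$ its complement. Then $\mathcal{I}(G)=\mathcal{A}(G)\cong\theta_{3,3,\ell}$.
   Context: For a graph $G$, an $i$-set is an independent dominating set of minimum cardinality and an $\alpha$-set is a maximum independent set. The $i$-graph $\mathcal{I}(G)$ has the $i$-sets as vertices, with $X\sim Y$ iff $Y=(X\setminus\{u\})\cup\{v\}$ for some $u\in X$, $v\notin X$ with $uv\in E(G)$; the $\alpha$-graph $\mathcal{A}(G)$ is defined the same way on the $\alpha$-sets. $\theta_{j,k,\ell}$ denotes two vertices joined by three internally vertex-disjoint paths of lengths $j,k,\ell$. -}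

module Defs where

open import Data.Nat using (ℕ; zero; suc; _+_; _∸_; _≤_; _<_)
open import Data.Fin using (Fin; toℕ)
open import Data.Fin.Subset using (Subset; _∈_; _∉_; ∣_∣; _─_; _∪_; ⁅_⁆)
open import Data.Product using (Σ; ∃; _×_; _,_)
open import Data.Sum using (_⊎_)
open import Relation.Nullary using (¬_)
open import Relation.Binary.PropositionalEquality using (_≡_; _≢_)
open import Function.Bundles using (_⇔_)

module _ {n : ℕ} (Adj : Fin n → Fin n → Set) where

  Independent : Subset n → Set
  Independent S = ∀ x y → x ∈ S → y ∈ S → ¬ Adj x y

  Dominating : Subset n → Set
  Dominating S = ∀ x → x ∈ S ⊎ (∃ λ y → y ∈ S × Adj x y)

  IndepDominating : Subset n → Set
  IndepDominating S = Independent S × Dominating S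

  IsISet : Subset n → Set
  IsISet S = IndepDominating S × (∀ T → IndepDominating T → ∣ S ∣ ≤ ∣ T ∣)

  IsAlphaSet : Subset n → Set
  IsAlphaSet S = Independent S × (∀ T → Independent T → ∣ T ∣ ≤ ∣ S ∣)

  -- adjacency in the i-graph / α-graph (same rule on both):
  -- Y = (X \ {u}) ∪ {v}, u ∈ X, v ∉ X, uv ∈ E(G)
  SlideAdj : Subset n → Subset n → Set
  SlideAdj X Y = ∃ λ u → ∃ λ v →
    u ∈ X × v ∉ X × Adj u v × Y ≡ (X ─ ⁅ u ⁆) ∪ ⁅ v ⁆

  record IGraphIso (V : Set) (AdjH : V → V → Set) : Set₁ where
    field
      f         : V → Subset n
      f-iset    : ∀ x → IsISet (f x)
      f-inj     : ∀ x y → f x ≡ f y → x ≡ y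
      f-surj    : ∀ S → IsISet S → ∃ λ x → f x ≡ S
      f-adj     : ∀ x y → AdjH x y ⇔ SlideAdj (f x) (f y)

Complement : {n : ℕ} → (Fin n → Fin n → Set) → Fin n → Fin n → Set
Complement A x y = x ≢ y × ¬ A x y

-- Theta graph θ_{j,k,l}: ends s, t joined by three internally disjoint
-- paths of lengths j, k, l.

data ThetaV (j k l : ℕ) : Set where
  endS : ThetaV j k l
  endT : ThetaV j k l
  in₁  : Fin (j ∸ 1) → ThetaV j k l
  in₂  : Fin (k ∸ 1) → ThetaV j k l
  in₃  : Fin (l ∸ 1) → ThetaV j k l

-- OnPath j k l r x p : vertex x lies on path r (r = 1,2,3) at position p
-- (endS at position 0, endT at position = length, interior i at i+1)
data OnPath (j k l : ℕ) : ℕ → ThetaV j k l → ℕ → Set where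
  s₁ : OnPath j k l 1 endS 0
  s₂ : OnPath j k l 2 endS 0
  s₃ : OnPath j k l 3 endS 0
  t₁ : OnPath j k l 1 endT j
  t₂ : OnPath j k l 2 endT k
  t₃ : OnPath j k l 3 endT l
  i₁ : (i : Fin (j ∸ 1)) → OnPath j k l 1 (in₁ i) (suc (toℕ i))
  i₂ : (i : Fin (k ∸ 1)) → OnPath j k l 2 (in₂ i) (suc (toℕ i))
  i₃ : (i : Fin (l ∸ 1)) → OnPath j k l 3 (in₃ i) (suc (toℕ i))

ThetaAdj : (j k l : ℕ) → ThetaV j k l → ThetaV j k l → Set
ThetaAdj j k l x y = ∃ λ r → ∃ λ p → ∃ λ q →
  OnPath j k l r x p × OnPath j k l r y q × (suc p ≡ q ⊎ suc q ≡ p)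

-- The graph Ḡ of the theorem, on vertices labelled by ℕ:
--   w_i ↦ i (i = 0..6),  v_j ↦ 6 + j (j = 1..ℓ-3);  so ℓ+4 vertices.

data BarEdge (ℓ : ℕ) : ℕ → ℕ → Set where
  hub   : ∀ i → 1 ≤ i → i ≤ 6 → BarEdge ℓ 0 i
  rim   : ∀ i → 1 ≤ i → i ≤ 5 → BarEdge ℓ i (suc i)
  rim61 : BarEdge ℓ 6 1
  path  : ∀ j → 1 ≤ j → j ≤ ℓ ∸ 4 → BarEdge ℓ (6 + j) (7 + j)
  w1v   : ∀ j → 1 ≤ j → j ≤ ℓ ∸ 4 → BarEdge ℓ 1 (6 + j)
  w2v1  : BarEdge ℓ 2 7
  w4v   : BarEdge ℓ 4 (6 + (ℓ ∸ 3))
  w5v₁  : BarEdge ℓ 5 (6 + (ℓ ∸ 4))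
  w5v₂  : BarEdge ℓ 5 (6 + (ℓ ∸ 3))
  vv    : BarEdge ℓ (6 + (ℓ ∸ 5)) (6 + (ℓ ∸ 3))

GBarAdj : (ℓ : ℕ) → Fin (ℓ + 4) → Fin (ℓ + 4) → Set
GBarAdj ℓ x y = BarEdge ℓ (toℕ x) (toℕ y) ⊎ BarEdge ℓ (toℕ y) (toℕ x)

GAdj : (ℓ : ℕ) → Fin (ℓ + 4) → Fin (ℓ + 4) → Set
GAdj ℓ = Complement (GBarAdj ℓ)

-- In G, the complement of Ḡ, independent sets are the cliques of Ḡ. Ḡ is K₄-free, every vertex
-- lies on an edge and every edge on a triangle; hence independent sets of G have at most three
-- vertices, independent dominating sets have at least three, and the independent dominating sets of
-- G are exactly the vertex sets of the triangles of Ḡ. As a maximum independent set is always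
-- dominating, i(G) = α(G) = 3 and the i-sets and α-sets are these triangles. Two triangles differ by
-- a slide exactly when they share an edge: the two unshared vertices cannot be adjacent in Ḡ, or
-- they would span a K₄ with the shared edge. Listing the triangles of Ḡ, the "shares an edge" graph
-- consists of three paths of lengths 3, 3 and ℓ from w₀w₁w₂ to w₀w₄w₅, i.e. it is θ_{3,3,ℓ}.

module Submission where

open import Data.Nat using (ℕ; zero; suc; _+_; _≤_; _<_; z≤n; s≤s; _≟_; _≤?_; _≤ᵇ_)
open import Data.Nat.Properties
  using (≤-refl; ≤-trans; ≤-pred; ≤-antisym; ≤-irrelevant; <⇒≤; <⇒≢; >⇒≢; <⇒≱; ≰⇒>; <-cmp; <-asym; <-irrefl;
         <-trans; n≤1+n; n<1+n; m≤m+n; +-comm; +-monoʳ-≤; ≤ᵇ⇒≤; suc-injective)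
open import Data.Bool using (Bool; true; false; T)
open import Data.Bool.Properties using (T-≡)
open import Data.Fin using (Fin; zero; suc; toℕ; fromℕ<)
open import Data.Fin.Properties using (any?; toℕ-injective; toℕ<n; toℕ-fromℕ<) renaming (_≟_ to _≟ᶠ_)
open import Data.Fin.Subset using (Subset; _∈_; _∉_; ∣_∣; _─_; _∪_; ⁅_⁆; _-_)
open import Data.Fin.Subset.Properties
  using (_∈?_; nonempty?; Empty-unique; ∣⊥∣≡0; p─⊥≡p; p─q⊆p; p⊆p∪q; p⊂q⇒∣p∣<∣q∣; ⊆-antisym;
         x∈p∪q⁻; x∈p∪q⁺; x∈⁅x⁆; x∈⁅y⁆⇒x≡y; x∈p∧x≢y⇒x∈p-y)
open import Data.Vec using (_∷_; here; there; tabulate)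
open import Data.Vec.Properties using (lookup∘tabulate; []=⇒lookup; lookup⇒[]=)
open import Data.Product using (∃; ∃₂; _×_; _,_)
open import Data.Sum using (_⊎_; inj₁; inj₂; swap)
open import Data.Empty using (⊥; ⊥-elim)
open import Relation.Nullary using (¬_; Dec; yes; no; contradiction)
open import Relation.Nullary.Decidable using (⌊_⌋; toWitness; fromWitness; map′; ¬?; _×-dec_; _⊎-dec_)
open import Relation.Binary.Definitions using (Decidable; Symmetric; tri<; tri≈; tri>)
open import Relation.Binary.PropositionalEquality using (_≡_; _≢_; refl; sym; trans; cong; subst; subst₂)
open import Function using (_∘′_; case_of_)
open import Function.Bundles using (_⇔_; mk⇔; Equivalence)
open import Function.Properties.Equivalence using () renaming (refl to ⇔-refl; sym to ⇔-sym; trans to ⇔-trans)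
open import Defs

∉-p-x : ∀ {n} (p : Subset n) x → x ∉ p - x
∉-p-x (_ ∷ p) zero ()
∉-p-x (_ ∷ p) (suc x) (there x∈p-x) = ∉-p-x p x x∈p-x

∈-p-x⁻ : ∀ {n} {p : Subset n} {x y} → y ∈ p - x → y ∈ p × y ≢ x
∈-p-x⁻ {p = p} {x} y∈p-x = p─q⊆p p ⁅ x ⁆ y∈p-x , λ { refl → ∉-p-x p x y∈p-x }

∣p∣≡1+∣p-x∣ : ∀ {n} (p : Subset n) x → x ∈ p → ∣ p ∣ ≡ suc ∣ p - x ∣
∣p∣≡1+∣p-x∣ (.true ∷ p) zero here = cong suc (cong ∣_∣ (sym (p─⊥≡p p)))
∣p∣≡1+∣p-x∣ (true ∷ p) (suc x) (there x∈p) = cong suc (∣p∣≡1+∣p-x∣ p x x∈p)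
∣p∣≡1+∣p-x∣ (false ∷ p) (suc x) (there x∈p) = ∣p∣≡1+∣p-x∣ p x x∈p

∈-replace : ∀ {n} {p : Subset n} {x y w} → w ∈ (p ─ ⁅ x ⁆) ∪ ⁅ y ⁆ ⇔ ((w ∈ p × w ≢ x) ⊎ w ≡ y)
∈-replace {p = p} {x} {y} {w} = mk⇔ to from
  where
  to : w ∈ (p ─ ⁅ x ⁆) ∪ ⁅ y ⁆ → (w ∈ p × w ≢ x) ⊎ w ≡ y
  to w∈ with x∈p∪q⁻ (p ─ ⁅ x ⁆) ⁅ y ⁆ w∈
  ... | inj₁ w∈p-x = inj₁ (∈-p-x⁻ w∈p-x)
  ... | inj₂ w∈y   = inj₂ (x∈⁅y⁆⇒x≡y y w∈y)
  from : (w ∈ p × w ≢ x) ⊎ w ≡ y → w ∈ (p ─ ⁅ x ⁆) ∪ ⁅ y ⁆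
  from (inj₁ (w∈p , w≢x)) = x∈p∪q⁺ (inj₁ (x∈p∧x≢y⇒x∈p-y w∈p w≢x))
  from (inj₂ refl)        = x∈p∪q⁺ {p = p ─ ⁅ x ⁆} (inj₂ (x∈⁅x⁆ y))

pickElement : ∀ {n} m (p : Subset n) → suc m ≤ ∣ p ∣ → ∃ λ x → x ∈ p × m ≤ ∣ p - x ∣
pickElement {n} m p 1+m≤∣p∣ with nonempty? p
... | yes (x , x∈p) = x , x∈p , ≤-pred (subst (suc m ≤_) (∣p∣≡1+∣p-x∣ p x x∈p) 1+m≤∣p∣)
... | no empty with Empty-unique empty
... | refl with () ← subst (suc m ≤_) (∣⊥∣≡0 n) 1+m≤∣p∣

record Distinct3 {n} (S : Subset n) : Set where
  constructor distinct3
  field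
    {x y z}    : Fin n
    x∈S        : x ∈ S
    y∈S        : y ∈ S
    z∈S        : z ∈ S
    x≢y        : x ≢ y
    x≢z        : x ≢ z
    y≢z        : y ≢ z

record Distinct4 {n} (S : Subset n) : Set where
  constructor distinct4
  field
    {w}        : Fin n
    others     : Distinct3 S
    w∈S        : w ∈ S
  open Distinct3 others
  field
    w≢x        : w ≢ x
    w≢y        : w ≢ y
    w≢z        : w ≢ z

Distinct3⇒3≤∣S∣ : ∀ {n} {S : Subset n} → Distinct3 S → 3 ≤ ∣ S ∣
Distinct3⇒3≤∣S∣ {S = S} (distinct3 {x} {y} {z} x∈S y∈S z∈S x≢y x≢z y≢z) =
  subst (3 ≤_) (sym ∣S∣≡3+∣S-x-y-z∣) (s≤s (s≤s (s≤s z≤n)))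
  where
  y∈S-x = x∈p∧x≢y⇒x∈p-y y∈S (λ e → x≢y (sym e))
  z∈S-x-y = x∈p∧x≢y⇒x∈p-y (x∈p∧x≢y⇒x∈p-y z∈S (λ e → x≢z (sym e))) (λ e → y≢z (sym e))
  ∣S∣≡3+∣S-x-y-z∣ : ∣ S ∣ ≡ 3 + ∣ S - x - y - z ∣
  ∣S∣≡3+∣S-x-y-z∣ rewrite ∣p∣≡1+∣p-x∣ S x x∈S | ∣p∣≡1+∣p-x∣ (S - x) y y∈S-x
                        | ∣p∣≡1+∣p-x∣ (S - x - y) z z∈S-x-y = refl

3≤∣S∣⇒Distinct3 : ∀ {n} (S : Subset n) → 3 ≤ ∣ S ∣ → Distinct3 S
3≤∣S∣⇒Distinct3 S 3≤∣S∣
  with x , x∈S , 2≤∣S-x∣ ← pickElement 2 S 3≤∣S∣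
  with y , y∈S-x , 1≤∣S-x-y∣ ← pickElement 1 (S - x) 2≤∣S-x∣
  with z , z∈S-x-y , _ ← pickElement 0 (S - x - y) 1≤∣S-x-y∣
  with y∈S , y≢x ← ∈-p-x⁻ y∈S-x
  with z∈S-x , z≢y ← ∈-p-x⁻ z∈S-x-y
  with z∈S , z≢x ← ∈-p-x⁻ z∈S-x
  = distinct3 x∈S y∈S z∈S (λ e → y≢x (sym e)) (λ e → z≢x (sym e)) (λ e → z≢y (sym e))

4≤∣S∣⇒Distinct4 : ∀ {n} (S : Subset n) → 4 ≤ ∣ S ∣ → Distinct4 S
4≤∣S∣⇒Distinct4 S 4≤∣S∣
  with w , w∈S , 3≤∣S-w∣ ← pickElement 3 S 4≤∣S∣
  with distinct3 x∈S-w y∈S-w z∈S-w x≢y x≢z y≢z ← 3≤∣S∣⇒Distinct3 (S - w) 3≤∣S-w∣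
  with x∈S , x≢w ← ∈-p-x⁻ x∈S-w
  with y∈S , y≢w ← ∈-p-x⁻ y∈S-w
  with z∈S , z≢w ← ∈-p-x⁻ z∈S-w
  = distinct4 (distinct3 x∈S y∈S z∈S x≢y x≢z y≢z) w∈S
      (λ e → x≢w (sym e)) (λ e → y≢w (sym e)) (λ e → z≢w (sym e))

-- Independent dominating and maximum independent sets

module _ {n : ℕ} {Adj : Fin n → Fin n → Set} where

  alphaSet⇒dominating : Decidable Adj → Symmetric Adj → (∀ x → ¬ Adj x x) →
                        ∀ {S} → IsAlphaSet Adj S → Dominating Adj S
  alphaSet⇒dominating adj? adj-sym adj-irrefl {S} (indep , maximum) x with x ∈? S
  ... | yes x∈S = inj₁ x∈S
  ... | no x∉S with any? (λ y → y ∈? S ×-dec adj? x y)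
  ... | yes dominated = inj₂ dominated
  ... | no undominated = contradiction (maximum (S ∪ ⁅ x ⁆) indep-S∪x) (<⇒≱ ∣S∣<∣S∪x∣)
    where
    ∣S∣<∣S∪x∣ : ∣ S ∣ < ∣ S ∪ ⁅ x ⁆ ∣
    ∣S∣<∣S∪x∣ = p⊂q⇒∣p∣<∣q∣ (p⊆p∪q ⁅ x ⁆ , x , x∈p∪q⁺ (inj₂ (x∈⁅x⁆ x)) , x∉S)
    indep-S∪x : Independent Adj (S ∪ ⁅ x ⁆)
    indep-S∪x y z y∈ z∈ with x∈p∪q⁻ S ⁅ x ⁆ y∈ | x∈p∪q⁻ S ⁅ x ⁆ z∈
    ... | inj₁ y∈S | inj₁ z∈S = indep y z y∈S z∈S
    ... | inj₁ y∈S | inj₂ z∈x with refl ← x∈⁅y⁆⇒x≡y x z∈x =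
      λ yx → undominated (y , y∈S , adj-sym yx)
    ... | inj₂ y∈x | inj₁ z∈S with refl ← x∈⁅y⁆⇒x≡y x y∈x = λ xz → undominated (z , z∈S , xz)
    ... | inj₂ y∈x | inj₂ z∈x with refl ← x∈⁅y⁆⇒x≡y x y∈x | refl ← x∈⁅y⁆⇒x≡y x z∈x = adj-irrefl x

  -- m ≤ i(G) and α(G) ≤ m force i(G) = α(G) = m.
  module Sandwiched (m : ℕ) (m≤i : ∀ T → IndepDominating Adj T → m ≤ ∣ T ∣)
                    (α≤m : ∀ T → Independent Adj T → ∣ T ∣ ≤ m) where

    indepDominating⇒iSet : ∀ {S} → IndepDominating Adj S → IsISet Adj S
    indepDominating⇒iSet S-id@(S-indep , _) = S-id , λ T T-id → ≤-trans (α≤m _ S-indep) (m≤i T T-id)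

    iSet⇒alphaSet : ∀ {S} → IsISet Adj S → IsAlphaSet Adj S
    iSet⇒alphaSet (S-id@(S-indep , _) , _) = S-indep , λ T T-indep → ≤-trans (α≤m T T-indep) (m≤i _ S-id)

    alphaSet⇒iSet : (∀ {S} → IsAlphaSet Adj S → Dominating Adj S) → ∀ {S} → IsAlphaSet Adj S → IsISet Adj S
    alphaSet⇒iSet α⇒dom S-α@(S-indep , _) = indepDominating⇒iSet (S-indep , α⇒dom S-α)

module _ {n : ℕ} {H : Fin n → Fin n → Set} (H-irrefl : ∀ x → ¬ H x x) where

  dominatorOutsideNeighbourhood : ∀ {S} → Dominating (Complement H) S →
                                  ∀ b → ∃ λ y → y ∈ S × (∀ x → H b x → y ≢ x)
  dominatorOutsideNeighbourhood dom b with dom b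
  ... | inj₁ b∈S = b , b∈S , λ { x bx refl → H-irrefl b bx }
  ... | inj₂ (y , y∈S , _ , ¬by) = y , y∈S , λ { x bx refl → ¬by bx }

data OneOf (a b c : ℕ) : ℕ → Set where
  1st : OneOf a b c a
  2nd : OneOf a b c b
  3rd : OneOf a b c c

oneOf? : ∀ a b c m → Dec (OneOf a b c m)
oneOf? a b c m with m ≟ a | m ≟ b | m ≟ c
... | yes refl | _ | _ = yes 1st
... | _ | yes refl | _ = yes 2nd
... | _ | _ | yes refl = yes 3rd
... | no m≢a | no m≢b | no m≢c = no λ { 1st → m≢a refl ; 2nd → m≢b refl ; 3rd → m≢c refl }

infix 4 _≐_
_≐_ : (ℕ → Set) → (ℕ → Set) → Set
P ≐ Q = ∀ m → P m ⇔ Q m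

≐-refl : ∀ {P} → P ≐ P
≐-refl m = mk⇔ (λ p → p) (λ p → p)

≐-sym : ∀ {P Q} → P ≐ Q → Q ≐ P
≐-sym P≐Q m = ⇔-sym (P≐Q m)

≐-trans : ∀ {P Q R} → P ≐ Q → Q ≐ R → P ≐ R
≐-trans P≐Q Q≐R m = ⇔-trans (P≐Q m) (Q≐R m)

module _ {a b c : ℕ} where

  OneOf-rotate : OneOf a b c ≐ OneOf b c a
  OneOf-rotate m = mk⇔ (λ { 1st → 3rd ; 2nd → 1st ; 3rd → 2nd }) (λ { 1st → 2nd ; 2nd → 3rd ; 3rd → 1st })

  OneOf-swap : OneOf a b c ≐ OneOf a c b
  OneOf-swap m = mk⇔ (λ { 1st → 1st ; 2nd → 3rd ; 3rd → 2nd }) (λ { 1st → 1st ; 2nd → 3rd ; 3rd → 2nd })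

module _ {a b c m : ℕ} (a<b : a < b) (b<c : b < c) where

  OneOf-sorted⇒≥min : OneOf a b c m → a ≤ m
  OneOf-sorted⇒≥min 1st = ≤-refl
  OneOf-sorted⇒≥min 2nd = <⇒≤ a<b
  OneOf-sorted⇒≥min 3rd = <⇒≤ (<-trans a<b b<c)

  OneOf-sorted⇒≤max : OneOf a b c m → m ≤ c
  OneOf-sorted⇒≤max 1st = <⇒≤ (<-trans a<b b<c)
  OneOf-sorted⇒≤max 2nd = <⇒≤ b<c
  OneOf-sorted⇒≤max 3rd = ≤-refl

sorted-OneOf-unique : ∀ {a b c a′ b′ c′} → a < b → b < c → a′ < b′ → b′ < c′ →
                      OneOf a b c ≐ OneOf a′ b′ c′ → a ≡ a′ × b ≡ b′ × c ≡ c′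
sorted-OneOf-unique {a} {b} {c} {a′} {b′} {c′} a<b b<c a′<b′ b′<c′ same = a≡a′ , b≡b′ (to b 2nd) , c≡c′
  where
  open module Same m = Equivalence (same m) using (to; from)
  a≡a′ = ≤-antisym (OneOf-sorted⇒≥min a<b b<c (from a′ 1st)) (OneOf-sorted⇒≥min a′<b′ b′<c′ (to a 1st))
  c≡c′ = ≤-antisym (OneOf-sorted⇒≤max a′<b′ b′<c′ (to c 3rd)) (OneOf-sorted⇒≤max a<b b<c (from c′ 3rd))
  b≡b′ : OneOf a′ b′ c′ b → b ≡ b′
  b≡b′ 1st = ⊥-elim (<-irrefl a≡a′ a<b)
  b≡b′ 2nd = refl
  b≡b′ 3rd = ⊥-elim (<-irrefl (sym c≡c′) b<c)

OneOf-replace : ∀ {x y u v m} → u ≢ x → u ≢ y → ((OneOf x y u m × m ≢ u) ⊎ m ≡ v) ⇔ OneOf x y v m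
OneOf-replace u≢x u≢y = mk⇔
  (λ { (inj₁ (1st , _)) → 1st ; (inj₁ (2nd , _)) → 2nd ; (inj₁ (3rd , m≢u)) → ⊥-elim (m≢u refl) ; (inj₂ refl) → 3rd })
  (λ { 1st → inj₁ (1st , λ x≡u → u≢x (sym x≡u)) ; 2nd → inj₁ (2nd , λ y≡u → u≢y (sym y≡u)) ; 3rd → inj₂ refl })

≢⇒¬OneOf : ∀ {a b c m} → m ≢ a → m ≢ b → m ≢ c → ¬ OneOf a b c m
≢⇒¬OneOf m≢a _ _ 1st = m≢a refl
≢⇒¬OneOf _ m≢b _ 2nd = m≢b refl
≢⇒¬OneOf _ _ m≢c 3rd = m≢c refl

∈-tabulate : ∀ {n} (f : Fin n → Bool) {x} → x ∈ tabulate f ⇔ T (f x)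
∈-tabulate f {x} = mk⇔
  (λ x∈ → Equivalence.from T-≡ (trans (sym (lookup∘tabulate f x)) ([]=⇒lookup x∈)))
  (λ fx → lookup⇒[]= x (tabulate f) (trans (lookup∘tabulate f x) (Equivalence.to T-≡ fx)))

triple : ∀ {n} → ℕ → ℕ → ℕ → Subset n
triple a b c = tabulate (λ x → ⌊ oneOf? a b c (toℕ x) ⌋)

∈-triple : ∀ {n a b c} {x : Fin n} → x ∈ triple a b c ⇔ OneOf a b c (toℕ x)
∈-triple = mk⇔ (λ x∈ → toWitness (Equivalence.to (∈-tabulate _) x∈))
               (λ h → Equivalence.from (∈-tabulate _) (fromWitness h))

record SortedEnumeration (P : ℕ → Set) : Set where
  constructor sorted
  field
    {a b c} : ℕ
    a<b     : a < b
    b<c     : b < c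
    same    : OneOf a b c ≐ P

sort3 : ∀ x y z → x ≢ y → x ≢ z → y ≢ z → SortedEnumeration (OneOf x y z)
sort3 x y z x≢y x≢z y≢z with <-cmp x y | <-cmp y z | <-cmp x z
... | tri≈ _ x≡y _ | _ | _ = ⊥-elim (x≢y x≡y)
... | _ | tri≈ _ y≡z _ | _ = ⊥-elim (y≢z y≡z)
... | _ | _ | tri≈ _ x≡z _ = ⊥-elim (x≢z x≡z)
... | tri< x<y _ _ | tri< y<z _ _ | _ = sorted x<y y<z ≐-refl
... | tri< x<y _ _ | tri> _ _ z<y | tri< x<z _ _ = sorted x<z z<y OneOf-swap
... | tri< x<y _ _ | tri> _ _ z<y | tri> _ _ z<x = sorted z<x x<y (≐-sym (≐-trans OneOf-rotate OneOf-rotate))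
... | tri> _ _ y<x | tri< y<z _ _ | tri< x<z _ _ = sorted y<x x<z (≐-trans OneOf-rotate OneOf-swap)
... | tri> _ _ y<x | tri< y<z _ _ | tri> _ _ z<x = sorted y<z z<x (≐-sym OneOf-rotate)
... | tri> _ _ y<x | tri> _ _ z<y | _ = sorted z<y y<x (≐-trans OneOf-rotate (≐-trans OneOf-rotate OneOf-swap))

-- The graph Ḡ and its triangles

-- BarEdge (6 + k) with every edge listed once, smaller label first; here ℓ = 6 + k, so
-- v_{ℓ-5}, v_{ℓ-4}, v_{ℓ-3} carry the labels 7 + k, 8 + k, 9 + k.
data Edge (k : ℕ) : ℕ → ℕ → Set where
  e01  : Edge k 0 1
  e02  : Edge k 0 2
  e03  : Edge k 0 3
  e04  : Edge k 0 4
  e05  : Edge k 0 5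
  e06  : Edge k 0 6
  e12  : Edge k 1 2
  e23  : Edge k 2 3
  e34  : Edge k 3 4
  e45  : Edge k 4 5
  e56  : Edge k 5 6
  e16  : Edge k 1 6
  path : ∀ j → j ≤ suc k → Edge k (7 + j) (8 + j)
  w1v  : ∀ j → j ≤ suc k → Edge k 1 (7 + j)
  w2v  : Edge k 2 7
  w4v  : Edge k 4 (9 + k)
  w5v′ : Edge k 5 (8 + k)
  w5v  : Edge k 5 (9 + k)
  vv   : Edge k (7 + k) (9 + k)

Adjacent : ℕ → ℕ → ℕ → Set
Adjacent k a b = Edge k a b ⊎ Edge k b a

module _ {k : ℕ} where

  Edge⇒< : ∀ {a b} → Edge k a b → a < b
  Edge⇒< e01        = s≤s z≤n
  Edge⇒< e02        = s≤s z≤n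
  Edge⇒< e03        = s≤s z≤n
  Edge⇒< e04        = s≤s z≤n
  Edge⇒< e05        = s≤s z≤n
  Edge⇒< e06        = s≤s z≤n
  Edge⇒< e12        = s≤s (s≤s z≤n)
  Edge⇒< e23        = s≤s (s≤s (s≤s z≤n))
  Edge⇒< e34        = s≤s (s≤s (s≤s (s≤s z≤n)))
  Edge⇒< e45        = s≤s (s≤s (s≤s (s≤s (s≤s z≤n))))
  Edge⇒< e56        = s≤s (s≤s (s≤s (s≤s (s≤s (s≤s z≤n)))))
  Edge⇒< e16        = s≤s (s≤s z≤n)
  Edge⇒< (path j _) = n<1+n _
  Edge⇒< (w1v j _)  = s≤s (s≤s z≤n)
  Edge⇒< w2v        = s≤s (s≤s (s≤s z≤n))
  Edge⇒< w4v        = s≤s (s≤s (s≤s (s≤s (s≤s z≤n))))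
  Edge⇒< w5v′       = s≤s (s≤s (s≤s (s≤s (s≤s (s≤s z≤n)))))
  Edge⇒< w5v        = s≤s (s≤s (s≤s (s≤s (s≤s (s≤s z≤n)))))
  Edge⇒< vv         = n≤1+n _

  Edge⇒≤max : ∀ {a b} → Edge k a b → b ≤ 9 + k
  Edge⇒≤max e01        = s≤s z≤n
  Edge⇒≤max e02        = s≤s (s≤s z≤n)
  Edge⇒≤max e03        = s≤s (s≤s (s≤s z≤n))
  Edge⇒≤max e04        = s≤s (s≤s (s≤s (s≤s z≤n)))
  Edge⇒≤max e05        = s≤s (s≤s (s≤s (s≤s (s≤s z≤n))))
  Edge⇒≤max e06        = s≤s (s≤s (s≤s (s≤s (s≤s (s≤s z≤n)))))
  Edge⇒≤max e12        = s≤s (s≤s z≤n)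
  Edge⇒≤max e23        = s≤s (s≤s (s≤s z≤n))
  Edge⇒≤max e34        = s≤s (s≤s (s≤s (s≤s z≤n)))
  Edge⇒≤max e45        = s≤s (s≤s (s≤s (s≤s (s≤s z≤n))))
  Edge⇒≤max e56        = s≤s (s≤s (s≤s (s≤s (s≤s (s≤s z≤n)))))
  Edge⇒≤max e16        = s≤s (s≤s (s≤s (s≤s (s≤s (s≤s z≤n)))))
  Edge⇒≤max (path j p) = s≤s (s≤s (s≤s (s≤s (s≤s (s≤s (s≤s (s≤s p)))))))
  Edge⇒≤max (w1v j p)  = s≤s (s≤s (s≤s (s≤s (s≤s (s≤s (s≤s (≤-trans p (n≤1+n _))))))))
  Edge⇒≤max w2v        = s≤s (s≤s (s≤s (s≤s (s≤s (s≤s (s≤s z≤n))))))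
  Edge⇒≤max w4v        = ≤-refl
  Edge⇒≤max w5v′       = n≤1+n _
  Edge⇒≤max w5v        = ≤-refl
  Edge⇒≤max vv         = ≤-refl

  BarEdge⇒Adjacent : ∀ {a b} → BarEdge (6 + k) a b → Adjacent k a b
  BarEdge⇒Adjacent (hub 1 _ _) = inj₁ e01
  BarEdge⇒Adjacent (hub 2 _ _) = inj₁ e02
  BarEdge⇒Adjacent (hub 3 _ _) = inj₁ e03
  BarEdge⇒Adjacent (hub 4 _ _) = inj₁ e04
  BarEdge⇒Adjacent (hub 5 _ _) = inj₁ e05
  BarEdge⇒Adjacent (hub 6 _ _) = inj₁ e06
  BarEdge⇒Adjacent (hub 0 () _)
  BarEdge⇒Adjacent (hub (suc (suc (suc (suc (suc (suc (suc _))))))) _ (s≤s (s≤s (s≤s (s≤s (s≤s (s≤s ())))))))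
  BarEdge⇒Adjacent (rim 1 _ _) = inj₁ e12
  BarEdge⇒Adjacent (rim 2 _ _) = inj₁ e23
  BarEdge⇒Adjacent (rim 3 _ _) = inj₁ e34
  BarEdge⇒Adjacent (rim 4 _ _) = inj₁ e45
  BarEdge⇒Adjacent (rim 5 _ _) = inj₁ e56
  BarEdge⇒Adjacent (rim 0 () _)
  BarEdge⇒Adjacent (rim (suc (suc (suc (suc (suc (suc _)))))) _ (s≤s (s≤s (s≤s (s≤s (s≤s ()))))))
  BarEdge⇒Adjacent rim61 = inj₂ e16
  BarEdge⇒Adjacent (path (suc j) _ (s≤s p)) = inj₁ (path j p)
  BarEdge⇒Adjacent (w1v (suc j) _ (s≤s p)) = inj₁ (w1v j p)
  BarEdge⇒Adjacent w2v1 = inj₁ w2v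
  BarEdge⇒Adjacent w4v  = inj₁ w4v
  BarEdge⇒Adjacent w5v₁ = inj₁ w5v′
  BarEdge⇒Adjacent w5v₂ = inj₁ w5v
  BarEdge⇒Adjacent vv   = inj₁ vv

  Edge⇒BarEdge : ∀ {a b} → Edge k a b → BarEdge (6 + k) a b ⊎ BarEdge (6 + k) b a
  Edge⇒BarEdge e01 = inj₁ (hub 1 (s≤s z≤n) (s≤s z≤n))
  Edge⇒BarEdge e02 = inj₁ (hub 2 (s≤s z≤n) (s≤s (s≤s z≤n)))
  Edge⇒BarEdge e03 = inj₁ (hub 3 (s≤s z≤n) (s≤s (s≤s (s≤s z≤n))))
  Edge⇒BarEdge e04 = inj₁ (hub 4 (s≤s z≤n) (s≤s (s≤s (s≤s (s≤s z≤n)))))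
  Edge⇒BarEdge e05 = inj₁ (hub 5 (s≤s z≤n) (s≤s (s≤s (s≤s (s≤s (s≤s z≤n))))))
  Edge⇒BarEdge e06 = inj₁ (hub 6 (s≤s z≤n) (s≤s (s≤s (s≤s (s≤s (s≤s (s≤s z≤n)))))))
  Edge⇒BarEdge e12 = inj₁ (rim 1 (s≤s z≤n) (s≤s z≤n))
  Edge⇒BarEdge e23 = inj₁ (rim 2 (s≤s z≤n) (s≤s (s≤s z≤n)))
  Edge⇒BarEdge e34 = inj₁ (rim 3 (s≤s z≤n) (s≤s (s≤s (s≤s z≤n))))
  Edge⇒BarEdge e45 = inj₁ (rim 4 (s≤s z≤n) (s≤s (s≤s (s≤s (s≤s z≤n)))))
  Edge⇒BarEdge e56 = inj₁ (rim 5 (s≤s z≤n) (s≤s (s≤s (s≤s (s≤s (s≤s z≤n))))))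
  Edge⇒BarEdge e16 = inj₂ rim61
  Edge⇒BarEdge (path j p) = inj₁ (path (suc j) (s≤s z≤n) (s≤s p))
  Edge⇒BarEdge (w1v j p)  = inj₁ (w1v (suc j) (s≤s z≤n) (s≤s p))
  Edge⇒BarEdge w2v  = inj₁ w2v1
  Edge⇒BarEdge w4v  = inj₁ w4v
  Edge⇒BarEdge w5v′ = inj₁ w5v₁
  Edge⇒BarEdge w5v  = inj₁ w5v₂
  Edge⇒BarEdge vv   = inj₁ vv

  edge? : ∀ a b → Dec (Edge k a b)
  edge? 0 0 = no λ ()
  edge? 0 1 = yes e01
  edge? 0 2 = yes e02
  edge? 0 3 = yes e03
  edge? 0 4 = yes e04
  edge? 0 5 = yes e05
  edge? 0 6 = yes e06
  edge? 0 (suc (suc (suc (suc (suc (suc (suc _))))))) = no λ ()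
  edge? 1 0 = no λ ()
  edge? 1 1 = no λ ()
  edge? 1 2 = yes e12
  edge? 1 3 = no λ ()
  edge? 1 4 = no λ ()
  edge? 1 5 = no λ ()
  edge? 1 6 = yes e16
  edge? 1 (suc (suc (suc (suc (suc (suc (suc j))))))) =
    map′ (w1v j) (λ { (w1v _ p) → p }) (j ≤? suc k)
  edge? 2 b = map′ (λ { (inj₁ refl) → e23 ; (inj₂ refl) → w2v })
                   (λ { e23 → inj₁ refl ; w2v → inj₂ refl })
                   (b ≟ 3 ⊎-dec b ≟ 7)
  edge? 3 b = map′ (λ { refl → e34 }) (λ { e34 → refl }) (b ≟ 4)
  edge? 4 b = map′ (λ { (inj₁ refl) → e45 ; (inj₂ refl) → w4v })
                   (λ { e45 → inj₁ refl ; w4v → inj₂ refl })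
                   (b ≟ 5 ⊎-dec b ≟ 9 + k)
  edge? 5 b = map′ (λ { (inj₁ refl) → e56 ; (inj₂ (inj₁ refl)) → w5v′ ; (inj₂ (inj₂ refl)) → w5v })
                   (λ { e56 → inj₁ refl ; w5v′ → inj₂ (inj₁ refl) ; w5v → inj₂ (inj₂ refl) })
                   (b ≟ 6 ⊎-dec b ≟ 8 + k ⊎-dec b ≟ 9 + k)
  edge? 6 b = no λ ()
  edge? (suc (suc (suc (suc (suc (suc (suc j))))))) b =
    map′ (λ { (inj₁ (refl , p)) → path j p ; (inj₂ (refl , refl)) → vv })
         (λ { (path _ p) → inj₁ (refl , p) ; vv → inj₂ (refl , refl) })
         ((b ≟ 8 + j ×-dec j ≤? suc k) ⊎-dec (j ≟ k ×-dec b ≟ 9 + k))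

  adjacent? : ∀ a b → Dec (Adjacent k a b)
  adjacent? a b = edge? a b ⊎-dec edge? b a

  Adjacent-irrefl : ∀ {a} → ¬ Adjacent k a a
  Adjacent-irrefl (inj₁ e) = <-irrefl refl (Edge⇒< e)
  Adjacent-irrefl (inj₂ e) = <-irrefl refl (Edge⇒< e)

  Adjacent-sym : ∀ {a b} → Adjacent k a b → Adjacent k b a
  Adjacent-sym (inj₁ e) = inj₂ e
  Adjacent-sym (inj₂ e) = inj₁ e

  Adjacent⇒Edge : ∀ {a b} → a < b → Adjacent k a b → Edge k a b
  Adjacent⇒Edge a<b (inj₁ e) = e
  Adjacent⇒Edge a<b (inj₂ e) = ⊥-elim (<-asym a<b (Edge⇒< e))

data Triangle (k : ℕ) : ℕ → ℕ → ℕ → Set where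
  t012 : Triangle k 0 1 2
  t016 : Triangle k 0 1 6
  t056 : Triangle k 0 5 6
  t023 : Triangle k 0 2 3
  t034 : Triangle k 0 3 4
  t045 : Triangle k 0 4 5
  t127 : Triangle k 1 2 7
  t1vv : ∀ j → j ≤ k → Triangle k 1 (7 + j) (8 + j)
  tvvv : Triangle k (7 + k) (8 + k) (9 + k)
  t5vv : Triangle k 5 (8 + k) (9 + k)
  t45v : Triangle k 4 5 (9 + k)

module _ {k : ℕ} where

  Triangle⇒Edges : ∀ {a b c} → Triangle k a b c → Edge k a b × Edge k b c × Edge k a c
  Triangle⇒Edges t012       = e01 , e12 , e02
  Triangle⇒Edges t016       = e01 , e16 , e06
  Triangle⇒Edges t056       = e05 , e56 , e06
  Triangle⇒Edges t023       = e02 , e23 , e03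
  Triangle⇒Edges t034       = e03 , e34 , e04
  Triangle⇒Edges t045       = e04 , e45 , e05
  Triangle⇒Edges t127       = e12 , w2v , w1v 0 z≤n
  Triangle⇒Edges (t1vv j p) = w1v j (≤-trans p (n≤1+n _)) , path j (≤-trans p (n≤1+n _)) , w1v (suc j) (s≤s p)
  Triangle⇒Edges tvvv       = path _ (n≤1+n _) , path _ ≤-refl , vv
  Triangle⇒Edges t5vv       = w5v′ , path _ ≤-refl , w5v
  Triangle⇒Edges t45v       = e45 , w5v , w4v

  Triangle⇒< : ∀ {a b c} → Triangle k a b c → a < b × b < c
  Triangle⇒< t with ab , bc , _ ← Triangle⇒Edges t = Edge⇒< ab , Edge⇒< bc

  Triangle-irrelevant : ∀ {a b c} (t t′ : Triangle k a b c) → t ≡ t′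
  Triangle-irrelevant t012       t012        = refl
  Triangle-irrelevant t016       t016        = refl
  Triangle-irrelevant t056       t056        = refl
  Triangle-irrelevant t023       t023        = refl
  Triangle-irrelevant t034       t034        = refl
  Triangle-irrelevant t045       t045        = refl
  Triangle-irrelevant t127       t127        = refl
  Triangle-irrelevant (t1vv j p) (t1vv .j q) = cong (t1vv j) (≤-irrelevant p q)
  Triangle-irrelevant tvvv       tvvv        = refl
  Triangle-irrelevant t5vv       t5vv        = refl
  Triangle-irrelevant t45v       t45v        = refl

  private
    no-consecutive-triangle : ∀ {a b c} → Edge k a b → Edge k b c → suc a ≢ c
    no-consecutive-triangle ab bc refl = <-irrefl refl (≤-trans (s≤s (Edge⇒< ab)) (Edge⇒< bc))

  edges⇒Triangle : ∀ {a b c} → Edge k a b → Edge k b c → Edge k a c → Triangle k a b c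
  edges⇒Triangle e01 e12 e02 = t012
  edges⇒Triangle e01 e16 e06 = t016
  edges⇒Triangle e05 e56 e06 = t056
  edges⇒Triangle e02 e23 e03 = t023
  edges⇒Triangle e03 e34 e04 = t034
  edges⇒Triangle e04 e45 e05 = t045
  edges⇒Triangle e12 w2v (w1v 0 _) = t127
  edges⇒Triangle (w1v j _) (path .j _) (w1v .(suc j) (s≤s p)) = t1vv j p
  edges⇒Triangle (path _ _) (path _ _) vv = tvvv
  edges⇒Triangle w5v′ (path _ _) w5v = t5vv
  edges⇒Triangle e45 w5v w4v = t45v
  edges⇒Triangle ab bc e01 = ⊥-elim (no-consecutive-triangle ab bc refl)
  edges⇒Triangle ab bc e12 = ⊥-elim (no-consecutive-triangle ab bc refl)
  edges⇒Triangle ab bc e23 = ⊥-elim (no-consecutive-triangle ab bc refl)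
  edges⇒Triangle ab bc e34 = ⊥-elim (no-consecutive-triangle ab bc refl)
  edges⇒Triangle ab bc e45 = ⊥-elim (no-consecutive-triangle ab bc refl)
  edges⇒Triangle ab bc e56 = ⊥-elim (no-consecutive-triangle ab bc refl)
  edges⇒Triangle ab bc (path _ _) = ⊥-elim (no-consecutive-triangle ab bc refl)
  edges⇒Triangle (w1v _ _) vv (w1v _ (s≤s p)) = ⊥-elim (<-irrefl refl p)
  edges⇒Triangle w5v bc w5v′ = ⊥-elim (<-asym (Edge⇒< bc) (n<1+n _))

  no-sorted-K4 : ∀ {a b c d} → Triangle k a b c → Triangle k b c d → ¬ Edge k a d
  no-sorted-K4 t012 t127 ()
  no-sorted-K4 t045 t45v ()
  no-sorted-K4 (t1vv _ _) tvvv (w1v _ (s≤s (s≤s p))) = <-irrefl refl p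

  -- Sort the fourth vertex d into a < b < c; each position yields a sorted K₄.
  no-K4 : ∀ {a b c d} → Triangle k a b c → Adjacent k d a → Adjacent k d b → Adjacent k d c → ⊥
  no-K4 {a} {b} {c} {d} t da db dc with ab , bc , ac ← Triangle⇒Edges t | <-cmp d a
  ... | tri≈ _ refl _ = Adjacent-irrefl da
  ... | tri< d<a _ _ = no-sorted-K4 (edges⇒Triangle Eda ab Edb) t (Adjacent⇒Edge (<-trans d<a (Edge⇒< ac)) dc)
    where
    Eda = Adjacent⇒Edge d<a da
    Edb = Adjacent⇒Edge (<-trans d<a (Edge⇒< ab)) db
  ... | tri> _ _ a<d with <-cmp d b
  ... | tri≈ _ refl _ = Adjacent-irrefl db
  ... | tri< d<b _ _ = no-sorted-K4 (edges⇒Triangle Ead Edb ab) (edges⇒Triangle Edb bc Edc) ac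
    where
    Ead = Adjacent⇒Edge a<d (Adjacent-sym da)
    Edb = Adjacent⇒Edge d<b db
    Edc = Adjacent⇒Edge (<-trans d<b (Edge⇒< bc)) dc
  ... | tri> _ _ b<d with <-cmp d c
  ... | tri≈ _ refl _ = Adjacent-irrefl dc
  ... | tri< d<c _ _ = no-sorted-K4 (edges⇒Triangle ab Ebd Ead) (edges⇒Triangle Ebd (Adjacent⇒Edge d<c dc) bc) ac
    where
    Ead = Adjacent⇒Edge a<d (Adjacent-sym da)
    Ebd = Adjacent⇒Edge b<d (Adjacent-sym db)
  ... | tri> _ _ c<d = no-sorted-K4 t (edges⇒Triangle bc Ecd Ebd) Ead
    where
    Ead = Adjacent⇒Edge a<d (Adjacent-sym da)
    Ebd = Adjacent⇒Edge b<d (Adjacent-sym db)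
    Ecd = Adjacent⇒Edge c<d (Adjacent-sym dc)

  private
    lit≤max : ∀ c → {T (c ≤ᵇ 9)} → c ≤ 9 + k
    lit≤max c {c≤9} = ≤-trans (≤ᵇ⇒≤ c 9 c≤9) (m≤m+n 9 k)

  neighbour : ∀ a → a ≤ 9 + k → ∃ λ b → b ≤ 9 + k × Adjacent k a b
  neighbour 0 _ = 1 , lit≤max 1 , inj₁ e01
  neighbour 1 _ = 0 , z≤n , inj₂ e01
  neighbour 2 _ = 0 , z≤n , inj₂ e02
  neighbour 3 _ = 0 , z≤n , inj₂ e03
  neighbour 4 _ = 0 , z≤n , inj₂ e04
  neighbour 5 _ = 0 , z≤n , inj₂ e05
  neighbour 6 _ = 0 , z≤n , inj₂ e06
  neighbour (suc (suc (suc (suc (suc (suc (suc j))))))) (s≤s (s≤s (s≤s (s≤s (s≤s (s≤s (s≤s j≤2+k))))))) with j ≤? suc k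
  ... | yes j≤1+k = 1 , lit≤max 1 , inj₂ (w1v j j≤1+k)
  ... | no j≰1+k with refl ← ≤-antisym j≤2+k (≰⇒> j≰1+k) = 5 , lit≤max 5 , inj₂ w5v

  Edge⇒commonNeighbour : ∀ {a b} → Edge k a b → ∃ λ c → c ≤ 9 + k × Adjacent k a c × Adjacent k b c
  Edge⇒commonNeighbour e01 = 2 , lit≤max 2 , inj₁ e02 , inj₁ e12
  Edge⇒commonNeighbour e02 = 1 , lit≤max 1 , inj₁ e01 , inj₂ e12
  Edge⇒commonNeighbour e03 = 2 , lit≤max 2 , inj₁ e02 , inj₂ e23
  Edge⇒commonNeighbour e04 = 3 , lit≤max 3 , inj₁ e03 , inj₂ e34
  Edge⇒commonNeighbour e05 = 4 , lit≤max 4 , inj₁ e04 , inj₂ e45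
  Edge⇒commonNeighbour e06 = 5 , lit≤max 5 , inj₁ e05 , inj₂ e56
  Edge⇒commonNeighbour e12 = 0 , z≤n , inj₂ e01 , inj₂ e02
  Edge⇒commonNeighbour e23 = 0 , z≤n , inj₂ e02 , inj₂ e03
  Edge⇒commonNeighbour e34 = 0 , z≤n , inj₂ e03 , inj₂ e04
  Edge⇒commonNeighbour e45 = 0 , z≤n , inj₂ e04 , inj₂ e05
  Edge⇒commonNeighbour e56 = 0 , z≤n , inj₂ e05 , inj₂ e06
  Edge⇒commonNeighbour e16 = 0 , z≤n , inj₂ e01 , inj₂ e06
  Edge⇒commonNeighbour (path j j≤1+k) with j ≤? k
  ... | yes j≤k = 1 , lit≤max 1 , inj₂ (w1v j j≤1+k) , inj₂ (w1v (suc j) (s≤s j≤k))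
  ... | no j≰k with refl ← ≤-antisym j≤1+k (≰⇒> j≰k) = 5 , lit≤max 5 , inj₂ w5v′ , inj₂ w5v
  Edge⇒commonNeighbour (w1v zero _) = 2 , lit≤max 2 , inj₁ e12 , inj₂ w2v
  Edge⇒commonNeighbour (w1v (suc j) j+1≤1+k) =
    7 + j , ≤-trans (+-monoʳ-≤ 7 j≤1+k) (n≤1+n _) , inj₁ (w1v j j≤1+k) , inj₂ (path j j≤1+k)
    where j≤1+k = ≤-trans (n≤1+n j) j+1≤1+k
  Edge⇒commonNeighbour w2v  = 1 , lit≤max 1 , inj₂ e12 , inj₂ (w1v 0 z≤n)
  Edge⇒commonNeighbour w4v  = 5 , lit≤max 5 , inj₁ e45 , inj₂ w5v
  Edge⇒commonNeighbour w5v′ = 9 + k , ≤-refl , inj₁ w5v , inj₁ (path (suc k) ≤-refl)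
  Edge⇒commonNeighbour w5v  = 4 , lit≤max 4 , inj₂ e45 , inj₂ w4v
  Edge⇒commonNeighbour vv   = 8 + k , n≤1+n _ , inj₁ (path k (n≤1+n k)) , inj₂ (path (suc k) ≤-refl)

  Adjacent⇒commonNeighbour : ∀ {a b} → Adjacent k a b → ∃ λ c → c ≤ 9 + k × Adjacent k a c × Adjacent k b c
  Adjacent⇒commonNeighbour (inj₁ ab) = Edge⇒commonNeighbour ab
  Adjacent⇒commonNeighbour (inj₂ ba) with c , c≤max , bc , ac ← Edge⇒commonNeighbour ba = c , c≤max , ac , bc

-- Triangles of Ḡ are the independent dominating sets of G

module _ (k : ℕ) where

  Vertex : Set
  Vertex = Fin (6 + k + 4)

  G : Vertex → Vertex → Set
  G = GAdj (6 + k)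

record Tri (k : ℕ) : Set where
  constructor ⟨_⟩
  field
    {a b c}  : ℕ
    triangle : Triangle k a b c

members : ∀ {k} → Tri k → ℕ → Set
members (⟨_⟩ {a} {b} {c} _) = OneOf a b c

triangleSet : ∀ {k} → Tri k → Subset (6 + k + 4)
triangleSet (⟨_⟩ {a} {b} {c} _) = triple a b c

module _ {k : ℕ} where

  toℕ≤max : (x : Vertex k) → toℕ x ≤ 9 + k
  toℕ≤max x = subst (λ n → toℕ x ≤ 5 + n) (+-comm k 4) (≤-pred (toℕ<n x))

  vertex : ∀ a → a ≤ 9 + k → Vertex k
  vertex a a≤max = fromℕ< (s≤s (subst (λ n → a ≤ 5 + n) (+-comm 4 k) a≤max))

  toℕ-vertex : ∀ a (a≤max : a ≤ 9 + k) → toℕ (vertex a a≤max) ≡ a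
  toℕ-vertex a a≤max = toℕ-fromℕ< _

  GBarAdj⇔Adjacent : ∀ {x y} → GBarAdj (6 + k) x y ⇔ Adjacent k (toℕ x) (toℕ y)
  GBarAdj⇔Adjacent = mk⇔ from-bar to-bar
    where
    from-bar : ∀ {x y} → GBarAdj (6 + k) x y → Adjacent k (toℕ x) (toℕ y)
    from-bar (inj₁ xy) = BarEdge⇒Adjacent xy
    from-bar (inj₂ yx) = Adjacent-sym (BarEdge⇒Adjacent yx)
    to-bar : ∀ {x y} → Adjacent k (toℕ x) (toℕ y) → GBarAdj (6 + k) x y
    to-bar (inj₁ xy) with Edge⇒BarEdge xy
    ... | inj₁ b = inj₁ b
    ... | inj₂ b = inj₂ b
    to-bar (inj₂ yx) with Edge⇒BarEdge yx
    ... | inj₁ b = inj₂ b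
    ... | inj₂ b = inj₁ b

  G? : Decidable (G k)
  G? x y = ¬? (x ≟ᶠ y) ×-dec ¬? (map′ (Equivalence.from GBarAdj⇔Adjacent) (Equivalence.to GBarAdj⇔Adjacent)
                                        (adjacent? (toℕ x) (toℕ y)))

  G-sym : Symmetric (G k)
  G-sym (x≢y , ¬xy) = (λ y≡x → x≢y (sym y≡x)) , λ yx → ¬xy (swap yx)

  G-irrefl : ∀ x → ¬ G k x x
  G-irrefl x (x≢x , _) = x≢x refl

  independent⇒Adjacent : ∀ {S} → Independent (G k) S → ∀ {x y} → x ∈ S → y ∈ S → x ≢ y → Adjacent k (toℕ x) (toℕ y)
  independent⇒Adjacent indep {x} {y} x∈S y∈S x≢y with adjacent? (toℕ x) (toℕ y)
  ... | yes xy = xy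
  ... | no ¬xy = ⊥-elim (indep x y x∈S y∈S (x≢y , λ xy → ¬xy (Equivalence.to GBarAdj⇔Adjacent xy)))

  Tri-≡ : {s t : Tri k} → members s ≐ members t → s ≡ t
  Tri-≡ {⟨ s ⟩} {⟨ t ⟩} same
    with a<b , b<c ← Triangle⇒< s | a′<b′ , b′<c′ ← Triangle⇒< t
    with refl , refl , refl ← sorted-OneOf-unique a<b b<c a′<b′ b′<c′ same
    = cong ⟨_⟩ (Triangle-irrelevant s t)

  members⇒≤max : ∀ (s : Tri k) {m} → members s m → m ≤ 9 + k
  members⇒≤max ⟨ t ⟩ m∈ with ab , bc , ac ← Triangle⇒Edges t with m∈
  ... | 1st = ≤-trans (<⇒≤ (Edge⇒< ab)) (Edge⇒≤max ab)
  ... | 2nd = Edge⇒≤max ab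
  ... | 3rd = Edge⇒≤max bc

  members-adjacent : ∀ (s : Tri k) {m m′} → members s m → members s m′ → m ≢ m′ → Adjacent k m m′
  members-adjacent ⟨ t ⟩ m∈ m′∈ m≢m′ with ab , bc , ac ← Triangle⇒Edges t | m∈ | m′∈
  ... | 1st | 2nd = inj₁ ab
  ... | 1st | 3rd = inj₁ ac
  ... | 2nd | 1st = inj₂ ab
  ... | 2nd | 3rd = inj₁ bc
  ... | 3rd | 1st = inj₂ ac
  ... | 3rd | 2nd = inj₂ bc
  ... | 1st | 1st = ⊥-elim (m≢m′ refl)
  ... | 2nd | 2nd = ⊥-elim (m≢m′ refl)
  ... | 3rd | 3rd = ⊥-elim (m≢m′ refl)

  ∈-triangleSet : ∀ (s : Tri k) {x} → x ∈ triangleSet s ⇔ members s (toℕ x)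
  ∈-triangleSet ⟨ _ ⟩ = ∈-triple

  vertex-∈-triangleSet : ∀ (s : Tri k) {m} (m≤max : m ≤ 9 + k) → members s m → vertex m m≤max ∈ triangleSet s
  vertex-∈-triangleSet s m≤max m∈ =
    Equivalence.from (∈-triangleSet s) (subst (members s) (sym (toℕ-vertex _ m≤max)) m∈)

  triangleSet-injective : ∀ {s t : Tri k} → triangleSet s ≡ triangleSet t → s ≡ t
  triangleSet-injective {s} {t} eq = Tri-≡ λ m → mk⇔ (transfer s t eq) (transfer t s (sym eq))
    where
    transfer : ∀ (s t : Tri k) {m} → triangleSet s ≡ triangleSet t → members s m → members t m
    transfer s t eq m∈ =
      subst (members t) (toℕ-vertex _ m≤max)
            (Equivalence.to (∈-triangleSet t) (subst (vertex _ m≤max ∈_) eq (vertex-∈-triangleSet s m≤max m∈)))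
      where m≤max = members⇒≤max s m∈

  triangleSet-independent : ∀ (s : Tri k) → Independent (G k) (triangleSet s)
  triangleSet-independent s x y x∈ y∈ (x≢y , ¬xy) =
    ¬xy (Equivalence.from GBarAdj⇔Adjacent
          (members-adjacent s (Equivalence.to (∈-triangleSet s) x∈) (Equivalence.to (∈-triangleSet s) y∈)
                            (λ e → x≢y (toℕ-injective e))))

  nonNeighbour : ∀ (s : Tri k) d → ∃ λ m → members s m × ¬ Adjacent k d m
  nonNeighbour ⟨ t ⟩ d with adjacent? d _ | adjacent? d _ | adjacent? d _
  ... | no ¬da | _ | _ = _ , 1st , ¬da
  ... | _ | no ¬db | _ = _ , 2nd , ¬db
  ... | _ | _ | no ¬dc = _ , 3rd , ¬dc
  ... | yes da | yes db | yes dc = ⊥-elim (no-K4 t da db dc)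

  triangleSet-dominating : ∀ (s : Tri k) → Dominating (G k) (triangleSet s)
  triangleSet-dominating s x with m , m∈ , ¬xm ← nonNeighbour s (toℕ x)
    with m≤max ← members⇒≤max s m∈ with x ≟ᶠ vertex m m≤max
  ... | yes refl = inj₁ (vertex-∈-triangleSet s m≤max m∈)
  ... | no x≢y   = inj₂ (_ , vertex-∈-triangleSet s m≤max m∈ , x≢y ,
                        λ xy → ¬xm (subst (Adjacent k (toℕ x)) (toℕ-vertex m m≤max) (Equivalence.to GBarAdj⇔Adjacent xy)))

  module _ {S : Subset (6 + k + 4)} (indep : Independent (G k) S) (d : Distinct3 S) where
    open Distinct3 d

    private
      Labels : ℕ → Set
      Labels = OneOf (toℕ x) (toℕ y) (toℕ z)

      labelled : ∀ {m} → Labels m → ∃ λ v → v ∈ S × toℕ v ≡ m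
      labelled 1st = x , x∈S , refl
      labelled 2nd = y , y∈S , refl
      labelled 3rd = z , z∈S , refl

      Labels-adjacent : ∀ {m m′} → Labels m → Labels m′ → m ≢ m′ → Adjacent k m m′
      Labels-adjacent m∈ m′∈ m≢m′ with v , v∈S , refl ← labelled m∈ | v′ , v′∈S , refl ← labelled m′∈ =
        independent⇒Adjacent indep v∈S v′∈S (λ { refl → m≢m′ refl })

      enumeration : SortedEnumeration Labels
      enumeration = sort3 (toℕ x) (toℕ y) (toℕ z) (λ e → x≢y (toℕ-injective e)) (λ e → x≢z (toℕ-injective e)) (λ e → y≢z (toℕ-injective e))
      open SortedEnumeration enumeration

    spanned : Tri k
    spanned = ⟨ edges⇒Triangle (edge a<b 1st 2nd) (edge b<c 2nd 3rd) (edge (<-trans a<b b<c) 1st 3rd) ⟩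
      where
      edge : ∀ {m m′} → m < m′ → OneOf a b c m → OneOf a b c m′ → Edge k m m′
      edge m<m′ m∈ m′∈ = Adjacent⇒Edge m<m′
        (Labels-adjacent (Equivalence.to (same _) m∈) (Equivalence.to (same _) m′∈) (λ { refl → <-irrefl refl m<m′ }))

    ∈⇒Labels : ∀ {w} → w ∈ S → Labels (toℕ w)
    ∈⇒Labels {w} w∈S with oneOf? (toℕ x) (toℕ y) (toℕ z) (toℕ w)
    ... | yes w∈ = w∈
    ... | no w∉ with m , m∈ , ¬wm ← nonNeighbour spanned (toℕ w)
                with v , v∈S , refl ← labelled (Equivalence.to (same _) m∈) =
      ⊥-elim (¬wm (independent⇒Adjacent indep w∈S v∈S λ { refl → w∉ (Equivalence.to (same _) m∈) }))

    S≡spanned : S ≡ triangleSet spanned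
    S≡spanned = ⊆-antisym
      (λ w∈S → Equivalence.from (∈-triangleSet spanned) (Equivalence.from (same _) (∈⇒Labels w∈S)))
      (λ {w} w∈ → case labelled (Equivalence.to (same _) (Equivalence.to (∈-triangleSet spanned) w∈)) of λ
                    { (v , v∈S , v≡w) → subst (_∈ S) (toℕ-injective v≡w) v∈S })

  independent⇒∣S∣≤3 : ∀ {S} → Independent (G k) S → ∣ S ∣ ≤ 3
  independent⇒∣S∣≤3 {S} indep with ∣ S ∣ ≤? 3
  ... | yes ∣S∣≤3 = ∣S∣≤3
  ... | no ∣S∣≰3 = ⊥-elim (no-Distinct4 (4≤∣S∣⇒Distinct4 S (≰⇒> ∣S∣≰3)))
    where
    no-Distinct4 : ¬ Distinct4 S
    no-Distinct4 d = ≢⇒¬OneOf (λ e → w≢x (toℕ-injective e)) (λ e → w≢y (toℕ-injective e)) (λ e → w≢z (toℕ-injective e))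
                              (∈⇒Labels indep others w∈S)
      where open Distinct4 d

  module _ {S : Subset (6 + k + 4)} (indep : Independent (G k) S) (dom : Dominating (G k) S) where
    private
      dominator : ∀ b → ∃ λ y → y ∈ S × (∀ x → GBarAdj (6 + k) b x → y ≢ x)
      dominator = dominatorOutsideNeighbourhood (λ _ xx → Adjacent-irrefl (Equivalence.to GBarAdj⇔Adjacent xx)) dom

      near : ∀ {a} (a≤max : a ≤ 9 + k) {v} → Adjacent k a (toℕ v) → GBarAdj (6 + k) (vertex a a≤max) v
      near {a} a≤max {v} av =
        Equivalence.from GBarAdj⇔Adjacent (subst (λ m → Adjacent k m (toℕ v)) (sym (toℕ-vertex a a≤max)) av)

      extend : ∀ {x y} → x ∈ S → y ∈ S → x ≢ y → Distinct3 S
      extend x∈S y∈S x≢y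
        with c , c≤max , xc , yc ← Adjacent⇒commonNeighbour (independent⇒Adjacent indep x∈S y∈S x≢y)
        with z , z∈S , z∉N[c] ← dominator (vertex c c≤max)
        = distinct3 x∈S y∈S z∈S x≢y (λ { refl → z∉N[c] _ (near c≤max (Adjacent-sym xc)) refl })
                                    (λ { refl → z∉N[c] _ (near c≤max (Adjacent-sym yc)) refl })

    indepDominating⇒Distinct3 : Distinct3 S
    indepDominating⇒Distinct3
      with x , x∈S , _ ← dominator zero
      with b , b≤max , xb ← neighbour (toℕ x) (toℕ≤max x)
      with y , y∈S , y∉N[b] ← dominator (vertex b b≤max)
      = extend x∈S y∈S (λ { refl → y∉N[b] _ (near b≤max (Adjacent-sym xb)) refl })

  indepDominating⇒triangleSet : ∀ {S} → IndepDominating (G k) S → ∃ λ s → triangleSet s ≡ S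
  indepDominating⇒triangleSet (indep , dom) = spanned indep three , sym (S≡spanned indep three)
    where three = indepDominating⇒Distinct3 indep dom

-- Triangles sharing an edge

-- Consecutive triangles along the three paths from t012 to t045, of lengths 3, 3 and 6 + k.
data Next (k : ℕ) : Tri k → Tri k → Set where
  t012→t016 : Next k ⟨ t012 ⟩ ⟨ t016 ⟩
  t016→t056 : Next k ⟨ t016 ⟩ ⟨ t056 ⟩
  t056→t045 : Next k ⟨ t056 ⟩ ⟨ t045 ⟩
  t012→t023 : Next k ⟨ t012 ⟩ ⟨ t023 ⟩
  t023→t034 : Next k ⟨ t023 ⟩ ⟨ t034 ⟩
  t034→t045 : Next k ⟨ t034 ⟩ ⟨ t045 ⟩
  t012→t127 : Next k ⟨ t012 ⟩ ⟨ t127 ⟩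
  t127→t1vv : ∀ p → Next k ⟨ t127 ⟩ ⟨ t1vv 0 p ⟩
  t1vv→t1vv : ∀ j p q → Next k ⟨ t1vv j p ⟩ ⟨ t1vv (suc j) q ⟩
  t1vv→tvvv : ∀ p → Next k ⟨ t1vv k p ⟩ ⟨ tvvv ⟩
  tvvv→t5vv : Next k ⟨ tvvv ⟩ ⟨ t5vv ⟩
  t5vv→t45v : Next k ⟨ t5vv ⟩ ⟨ t45v ⟩
  t45v→t045 : Next k ⟨ t45v ⟩ ⟨ t045 ⟩

Consecutive : ∀ k → Tri k → Tri k → Set
Consecutive k s t = Next k s t ⊎ Next k t s

data Placement (x y u : ℕ) : ℕ → ℕ → ℕ → Set where
  first  : Placement x y u u x y
  second : Placement x y u x u y
  third  : Placement x y u x y u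

placement : ∀ {x y u a b c} → x < y → u ≢ x → u ≢ y → a < b → b < c →
            OneOf a b c ≐ OneOf x y u → Placement x y u a b c
placement {x} {y} {u} x<y u≢x u≢y a<b b<c same with <-cmp u x | <-cmp u y
... | tri≈ _ u≡x _ | _ = ⊥-elim (u≢x u≡x)
... | _ | tri≈ _ u≡y _ = ⊥-elim (u≢y u≡y)
... | tri< u<x _ _ | _ with refl , refl , refl ← sorted-OneOf-unique a<b b<c u<x x<y (≐-trans same (≐-trans OneOf-rotate OneOf-rotate)) = first
... | tri> _ _ x<u | tri< u<y _ _ with refl , refl , refl ← sorted-OneOf-unique a<b b<c x<u u<y (≐-trans same OneOf-swap) = second
... | tri> _ _ x<u | tri> _ _ y<u with refl , refl , refl ← sorted-OneOf-unique a<b b<c x<y y<u same = third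

-- consecutive-atᵢⱼ: two triangles sharing the pair x < y, whose other vertex is the i-th of the
-- first and the j-th of the second in increasing order.
module _ {k : ℕ} where

  consecutive-at₁₁ : ∀ {x y u v} (X : Triangle k u x y) (Y : Triangle k v x y) → u ≢ v → Consecutive k ⟨ X ⟩ ⟨ Y ⟩
  consecutive-at₁₁ tvvv tvvv u≢v = ⊥-elim (u≢v refl)
  consecutive-at₁₁ tvvv t5vv _ = inj₁ tvvv→t5vv
  consecutive-at₁₁ t5vv tvvv _ = inj₂ tvvv→t5vv
  consecutive-at₁₁ t5vv t5vv u≢v = ⊥-elim (u≢v refl)
  consecutive-at₁₁ (t1vv _ p) tvvv _ = ⊥-elim (<-irrefl refl p)
  consecutive-at₁₁ (t1vv _ p) t5vv _ = ⊥-elim (<-irrefl refl p)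
  consecutive-at₁₁ tvvv (t1vv _ p) _ = ⊥-elim (<-irrefl refl p)
  consecutive-at₁₁ t5vv (t1vv _ p) _ = ⊥-elim (<-irrefl refl p)
  consecutive-at₁₁ t012 t012 u≢v = ⊥-elim (u≢v refl)
  consecutive-at₁₁ t016 t016 u≢v = ⊥-elim (u≢v refl)
  consecutive-at₁₁ t056 t056 u≢v = ⊥-elim (u≢v refl)
  consecutive-at₁₁ t023 t023 u≢v = ⊥-elim (u≢v refl)
  consecutive-at₁₁ t034 t034 u≢v = ⊥-elim (u≢v refl)
  consecutive-at₁₁ t045 t045 u≢v = ⊥-elim (u≢v refl)
  consecutive-at₁₁ t127 t127 u≢v = ⊥-elim (u≢v refl)
  consecutive-at₁₁ (t1vv _ _) (t1vv _ _) u≢v = ⊥-elim (u≢v refl)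
  consecutive-at₁₁ t45v t45v u≢v = ⊥-elim (u≢v refl)

  consecutive-at₁₂ : ∀ {x y u v} (X : Triangle k u x y) (Y : Triangle k x v y) → Consecutive k ⟨ X ⟩ ⟨ Y ⟩
  consecutive-at₁₂ t45v t5vv = inj₂ t5vv→t45v

  consecutive-at₁₃ : ∀ {x y u v} (X : Triangle k u x y) (Y : Triangle k x y v) → Consecutive k ⟨ X ⟩ ⟨ Y ⟩
  consecutive-at₁₃ t012 t127 = inj₁ t012→t127
  consecutive-at₁₃ (t1vv _ p) tvvv = inj₁ (t1vv→tvvv p)
  consecutive-at₁₃ t045 t45v = inj₂ t45v→t045

  consecutive-at₂₂ : ∀ {x y u v} (X : Triangle k x u y) (Y : Triangle k x v y) → u ≢ v → Consecutive k ⟨ X ⟩ ⟨ Y ⟩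
  consecutive-at₂₂ t016 t056 _ = inj₁ t016→t056
  consecutive-at₂₂ t056 t016 _ = inj₂ t016→t056
  consecutive-at₂₂ t012 t012 u≢v = ⊥-elim (u≢v refl)
  consecutive-at₂₂ t016 t016 u≢v = ⊥-elim (u≢v refl)
  consecutive-at₂₂ t056 t056 u≢v = ⊥-elim (u≢v refl)
  consecutive-at₂₂ t023 t023 u≢v = ⊥-elim (u≢v refl)
  consecutive-at₂₂ t034 t034 u≢v = ⊥-elim (u≢v refl)
  consecutive-at₂₂ t045 t045 u≢v = ⊥-elim (u≢v refl)
  consecutive-at₂₂ t127 t127 u≢v = ⊥-elim (u≢v refl)
  consecutive-at₂₂ (t1vv _ _) (t1vv _ _) u≢v = ⊥-elim (u≢v refl)
  consecutive-at₂₂ tvvv tvvv u≢v = ⊥-elim (u≢v refl)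
  consecutive-at₂₂ t5vv t5vv u≢v = ⊥-elim (u≢v refl)
  consecutive-at₂₂ t45v t45v u≢v = ⊥-elim (u≢v refl)

  consecutive-at₂₃ : ∀ {x y u v} (X : Triangle k x u y) (Y : Triangle k x y v) → Consecutive k ⟨ X ⟩ ⟨ Y ⟩
  consecutive-at₂₃ t045 t056 = inj₂ t056→t045
  consecutive-at₂₃ t012 t023 = inj₁ t012→t023
  consecutive-at₂₃ t023 t034 = inj₁ t023→t034
  consecutive-at₂₃ t034 t045 = inj₁ t034→t045
  consecutive-at₂₃ t127 (t1vv _ p) = inj₁ (t127→t1vv p)
  consecutive-at₂₃ (t1vv j p) (t1vv _ q) = inj₁ (t1vv→t1vv j p q)

  consecutive-at₃₃ : ∀ {x y u v} (X : Triangle k x y u) (Y : Triangle k x y v) → u ≢ v → Consecutive k ⟨ X ⟩ ⟨ Y ⟩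
  consecutive-at₃₃ t012 t016 _ = inj₁ t012→t016
  consecutive-at₃₃ t016 t012 _ = inj₂ t012→t016
  consecutive-at₃₃ t012 t012 u≢v = ⊥-elim (u≢v refl)
  consecutive-at₃₃ t016 t016 u≢v = ⊥-elim (u≢v refl)
  consecutive-at₃₃ t056 t056 u≢v = ⊥-elim (u≢v refl)
  consecutive-at₃₃ t023 t023 u≢v = ⊥-elim (u≢v refl)
  consecutive-at₃₃ t034 t034 u≢v = ⊥-elim (u≢v refl)
  consecutive-at₃₃ t045 t045 u≢v = ⊥-elim (u≢v refl)
  consecutive-at₃₃ t127 t127 u≢v = ⊥-elim (u≢v refl)
  consecutive-at₃₃ (t1vv _ _) (t1vv _ _) u≢v = ⊥-elim (u≢v refl)
  consecutive-at₃₃ tvvv tvvv u≢v = ⊥-elim (u≢v refl)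
  consecutive-at₃₃ t5vv t5vv u≢v = ⊥-elim (u≢v refl)
  consecutive-at₃₃ t45v t45v u≢v = ⊥-elim (u≢v refl)

record SharesEdge {k} (s t : Tri k) : Set where
  constructor sharing
  field
    {x y u v} : ℕ
    x<y       : x < y
    s≐xyu     : members s ≐ OneOf x y u
    t≐xyv     : members t ≐ OneOf x y v
    u≢x       : u ≢ x
    u≢y       : u ≢ y
    v≢x       : v ≢ x
    v≢y       : v ≢ y
    u≢v       : u ≢ v

module _ {k : ℕ} where

  SharesEdge⇒Consecutive : ∀ {s t : Tri k} → SharesEdge s t → Consecutive k s t
  SharesEdge⇒Consecutive {⟨ X ⟩} {⟨ Y ⟩} (sharing x<y s≐ t≐ u≢x u≢y v≢x v≢y u≢v)
    with a<b , b<c ← Triangle⇒< X | a′<b′ , b′<c′ ← Triangle⇒< Y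
    with placement x<y u≢x u≢y a<b b<c s≐ | placement x<y v≢x v≢y a′<b′ b′<c′ t≐
  ... | first  | first  = consecutive-at₁₁ X Y u≢v
  ... | first  | second = consecutive-at₁₂ X Y
  ... | first  | third  = consecutive-at₁₃ X Y
  ... | second | first  = swap (consecutive-at₁₂ Y X)
  ... | second | second = consecutive-at₂₂ X Y u≢v
  ... | second | third  = consecutive-at₂₃ X Y
  ... | third  | first  = swap (consecutive-at₁₃ Y X)
  ... | third  | second = swap (consecutive-at₂₃ Y X)
  ... | third  | third  = consecutive-at₃₃ X Y u≢v

  SharesEdge-sym : ∀ {s t : Tri k} → SharesEdge s t → SharesEdge t s
  SharesEdge-sym (sharing x<y s≐ t≐ u≢x u≢y v≢x v≢y u≢v) = sharing x<y t≐ s≐ v≢x v≢y u≢x u≢y (λ v≡u → u≢v (sym v≡u))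

  Next⇒SharesEdge : ∀ {s t : Tri k} → Next k s t → SharesEdge s t
  Next⇒SharesEdge t012→t016 = sharing (s≤s z≤n) ≐-refl ≐-refl (λ ()) (λ ()) (λ ()) (λ ()) (λ ())
  Next⇒SharesEdge t016→t056 = sharing (s≤s z≤n) OneOf-swap OneOf-swap (λ ()) (λ ()) (λ ()) (λ ()) (λ ())
  Next⇒SharesEdge t056→t045 = sharing (s≤s z≤n) ≐-refl OneOf-swap (λ ()) (λ ()) (λ ()) (λ ()) (λ ())
  Next⇒SharesEdge t012→t023 = sharing (s≤s z≤n) OneOf-swap ≐-refl (λ ()) (λ ()) (λ ()) (λ ()) (λ ())
  Next⇒SharesEdge t023→t034 = sharing (s≤s z≤n) OneOf-swap ≐-refl (λ ()) (λ ()) (λ ()) (λ ()) (λ ())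
  Next⇒SharesEdge t034→t045 = sharing (s≤s z≤n) OneOf-swap ≐-refl (λ ()) (λ ()) (λ ()) (λ ()) (λ ())
  Next⇒SharesEdge t012→t127 = sharing (s≤s (s≤s z≤n)) OneOf-rotate ≐-refl (λ ()) (λ ()) (λ ()) (λ ()) (λ ())
  Next⇒SharesEdge (t127→t1vv _) = sharing (s≤s (s≤s z≤n)) OneOf-swap ≐-refl (λ ()) (λ ()) (λ ()) (λ ()) (λ ())
  Next⇒SharesEdge (t1vv→t1vv _ _ _) = sharing (s≤s (s≤s z≤n)) OneOf-swap ≐-refl (λ ()) (λ ()) (λ ()) (λ ()) (λ ())
  Next⇒SharesEdge (t1vv→tvvv _) = sharing (n<1+n _) OneOf-rotate ≐-refl (λ ()) (λ ()) (λ ()) (λ ()) (λ ())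
  Next⇒SharesEdge tvvv→t5vv = sharing (n<1+n _) OneOf-rotate OneOf-rotate (λ ()) (λ ()) (λ ()) (λ ()) (λ ())
  Next⇒SharesEdge t5vv→t45v = sharing (s≤s (s≤s (s≤s (s≤s (s≤s (s≤s z≤n)))))) OneOf-swap OneOf-rotate (λ ()) (λ ()) (λ ()) (λ ()) (λ ())
  Next⇒SharesEdge t45v→t045 = sharing (n<1+n _) ≐-refl OneOf-rotate (λ ()) (λ ()) (λ ()) (λ ()) (λ ())

  SharesEdge⇔Consecutive : ∀ {s t : Tri k} → SharesEdge s t ⇔ Consecutive k s t
  SharesEdge⇔Consecutive = mk⇔ SharesEdge⇒Consecutive
    λ { (inj₁ next) → Next⇒SharesEdge next ; (inj₂ next) → SharesEdge-sym (Next⇒SharesEdge next) }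

-- Slides

module _ {k : ℕ} where

  splitOff : ∀ (s : Tri k) {m} → members s m →
             ∃₂ λ x y → x < y × members s ≐ OneOf x y m × m ≢ x × m ≢ y
  splitOff ⟨ X ⟩ m∈ with a<b , b<c ← Triangle⇒< X | m∈
  ... | 1st = _ , _ , b<c , OneOf-rotate , <⇒≢ a<b , <⇒≢ (<-trans a<b b<c)
  ... | 2nd = _ , _ , <-trans a<b b<c , OneOf-swap , >⇒≢ a<b , <⇒≢ b<c
  ... | 3rd = _ , _ , a<b , ≐-refl , >⇒≢ (<-trans a<b b<c) , >⇒≢ b<c

  ≐-from-vertices : ∀ (s : Tri k) {P : ℕ → Set} → (∀ {m} → P m → m ≤ 9 + k) →
                    (∀ w → members s (toℕ w) ⇔ P (toℕ w)) → members s ≐ P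
  ≐-from-vertices s {P} P⇒≤max same m =
    mk⇔ (λ m∈ → Equivalence.to (at (members⇒≤max s m∈)) m∈) (λ Pm → Equivalence.from (at (P⇒≤max Pm)) Pm)
    where
    at : m ≤ 9 + k → members s m ⇔ P m
    at m≤max = subst (λ n → members s n ⇔ P n) (toℕ-vertex m m≤max) (same (vertex m m≤max))

  ∈-replace-members : ∀ (s : Tri k) {u v w} →
                      w ∈ (triangleSet s ─ ⁅ u ⁆) ∪ ⁅ v ⁆ ⇔ ((members s (toℕ w) × toℕ w ≢ toℕ u) ⊎ toℕ w ≡ toℕ v)
  ∈-replace-members s = ⇔-trans ∈-replace (mk⇔
    (λ { (inj₁ (w∈ , w≢u)) → inj₁ (Equivalence.to (∈-triangleSet s) w∈ , λ e → w≢u (toℕ-injective e)) ; (inj₂ refl) → inj₂ refl })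
    (λ { (inj₁ (w∈ , w≢u)) → inj₁ (Equivalence.from (∈-triangleSet s) w∈ , λ { refl → w≢u refl }) ; (inj₂ e) → inj₂ (toℕ-injective e) }))

  replace-members : ∀ (s : Tri k) {x y u v n} → members s ≐ OneOf x y u → u ≢ x → u ≢ y →
                    ((members s n × n ≢ u) ⊎ n ≡ v) ⇔ OneOf x y v n
  replace-members s s≐ u≢x u≢y = ⇔-trans (mk⇔
    (λ { (inj₁ (n∈ , n≢u)) → inj₁ (Equivalence.to (s≐ _) n∈ , n≢u) ; (inj₂ e) → inj₂ e })
    (λ { (inj₁ (n∈ , n≢u)) → inj₁ (Equivalence.from (s≐ _) n∈ , n≢u) ; (inj₂ e) → inj₂ e }))
    (OneOf-replace u≢x u≢y)

  slide⇒SharesEdge : ∀ {s t : Tri k} → SlideAdj (G k) (triangleSet s) (triangleSet t) → SharesEdge s t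
  slide⇒SharesEdge {s} {t} (u , v , u∈s , v∉s , _ , t≡s-u+v)
    with x , y , x<y , s≐ , u≢x , u≢y ← splitOff s (Equivalence.to (∈-triangleSet s) u∈s)
    = sharing x<y s≐ t≐ u≢x u≢y (v∉s ∘′ x∈) (v∉s ∘′ y∈) (λ e → v∉s (subst (_∈ triangleSet s) (toℕ-injective e) u∈s))
    where
    x∈ : toℕ v ≡ x → v ∈ triangleSet s
    x∈ refl = Equivalence.from (∈-triangleSet s) (Equivalence.from (s≐ _) 1st)
    y∈ : toℕ v ≡ y → v ∈ triangleSet s
    y∈ refl = Equivalence.from (∈-triangleSet s) (Equivalence.from (s≐ _) 2nd)
    t≐ : members t ≐ OneOf x y (toℕ v)
    t≐ = ≐-from-vertices t bound λ w →
      ⇔-trans (⇔-sym (∈-triangleSet t)) (⇔-trans (subst (λ S → (w ∈ triangleSet t) ⇔ (w ∈ S)) t≡s-u+v ⇔-refl)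
        (⇔-trans (∈-replace-members s) (replace-members s s≐ u≢x u≢y)))
      where
      bound : ∀ {m} → OneOf x y (toℕ v) m → m ≤ 9 + k
      bound 1st = members⇒≤max s (Equivalence.from (s≐ _) 1st)
      bound 2nd = members⇒≤max s (Equivalence.from (s≐ _) 2nd)
      bound 3rd = toℕ≤max v

  SharesEdge⇒slide : ∀ {s t : Tri k} → SharesEdge s t → SlideAdj (G k) (triangleSet s) (triangleSet t)
  SharesEdge⇒slide {s} {t} (sharing {x} {y} {û} {v̂} _ s≐ t≐ u≢x u≢y v≢x v≢y u≢v) =
    slide (vertex û û≤max) (vertex v̂ v̂≤max) (toℕ-vertex û û≤max) (toℕ-vertex v̂ v̂≤max)
    where
    û∈s = Equivalence.from (s≐ û) 3rd
    v̂∈t = Equivalence.from (t≐ v̂) 3rd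
    û≤max = members⇒≤max s û∈s
    v̂≤max = members⇒≤max t v̂∈t
    slide : ∀ u v → toℕ u ≡ û → toℕ v ≡ v̂ → SlideAdj (G k) (triangleSet s) (triangleSet t)
    slide u v refl refl = u , v , u∈s , v∉s , ((λ { refl → u≢v refl }) , ¬uv) , t≡s-u+v
      where
      u∈s = Equivalence.from (∈-triangleSet s) û∈s
      v∉s : ¬ v ∈ triangleSet s
      v∉s v∈s = ≢⇒¬OneOf v≢x v≢y (λ e → u≢v (sym e)) (Equivalence.to (s≐ _) (Equivalence.to (∈-triangleSet s) v∈s))
      -- In Ḡ the vertex u is adjacent to x and y; adjacent to v too would make a K₄ with t.
      ¬uv : ¬ GBarAdj (6 + k) u v
      ¬uv uv with m , m∈t , ¬um ← nonNeighbour t (toℕ u) with Equivalence.to (t≐ m) m∈t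
      ... | 1st = ¬um (members-adjacent s û∈s (Equivalence.from (s≐ _) 1st) u≢x)
      ... | 2nd = ¬um (members-adjacent s û∈s (Equivalence.from (s≐ _) 2nd) u≢y)
      ... | 3rd = ¬um (Equivalence.to GBarAdj⇔Adjacent uv)
      t≡s-u+v : triangleSet t ≡ (triangleSet s ─ ⁅ u ⁆) ∪ ⁅ v ⁆
      t≡s-u+v = ⊆-antisym (λ {w} → Equivalence.to (same w)) (λ {w} → Equivalence.from (same w))
        where
        same : ∀ w → w ∈ triangleSet t ⇔ w ∈ (triangleSet s ─ ⁅ u ⁆) ∪ ⁅ v ⁆
        same w = ⇔-trans (∈-triangleSet t) (⇔-trans (t≐ _)
                   (⇔-sym (⇔-trans (∈-replace-members s) (replace-members s s≐ u≢x u≢y))))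

  slide⇔SharesEdge : ∀ {s t : Tri k} → SlideAdj (G k) (triangleSet s) (triangleSet t) ⇔ SharesEdge s t
  slide⇔SharesEdge = mk⇔ slide⇒SharesEdge SharesEdge⇒slide

-- The θ-graph

Θ : ℕ → Set
Θ k = ThetaV 3 3 (6 + k)

-- The interior vertex in₃ (suc j) of the long path of θ_{3,3,6+k} is the triangle t1vv j for j ≤ k,
-- followed by tvvv, t5vv and t45v.
data LongPathIndex (k : ℕ) : ℕ → Set where
  at-t1vv : ∀ j → j ≤ k → LongPathIndex k j
  at-tvvv : LongPathIndex k (1 + k)
  at-t5vv : LongPathIndex k (2 + k)
  at-t45v : LongPathIndex k (3 + k)

module _ {k : ℕ} where

  longPathIndex : ∀ j → j < 4 + k → LongPathIndex k j
  longPathIndex = index k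
    where
    lift : ∀ {k j} → LongPathIndex k j → LongPathIndex (suc k) (suc j)
    lift (at-t1vv j p) = at-t1vv (suc j) (s≤s p)
    lift at-tvvv = at-tvvv
    lift at-t5vv = at-t5vv
    lift at-t45v = at-t45v
    index : ∀ k j → j < 4 + k → LongPathIndex k j
    index k zero _ = at-t1vv 0 z≤n
    index zero 1 _ = at-tvvv
    index zero 2 _ = at-t5vv
    index zero 3 _ = at-t45v
    index zero (suc (suc (suc (suc _)))) (s≤s (s≤s (s≤s (s≤s ()))))
    index (suc k) (suc j) (s≤s j<4+k) = lift (index k j j<4+k)

  LongPathIndex-irrelevant : ∀ {j} (p q : LongPathIndex k j) → p ≡ q
  LongPathIndex-irrelevant (at-t1vv j p) (at-t1vv .j q) = cong (at-t1vv j) (≤-irrelevant p q)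
  LongPathIndex-irrelevant (at-t1vv _ p) at-tvvv = ⊥-elim (<-irrefl refl p)
  LongPathIndex-irrelevant (at-t1vv _ p) at-t5vv = ⊥-elim (<-irrefl refl (≤-trans (n≤1+n _) p))
  LongPathIndex-irrelevant (at-t1vv _ p) at-t45v = ⊥-elim (<-irrefl refl (≤-trans (n≤1+n _) (≤-trans (n≤1+n _) p)))
  LongPathIndex-irrelevant at-tvvv (at-t1vv _ p) = ⊥-elim (<-irrefl refl p)
  LongPathIndex-irrelevant at-tvvv at-tvvv = refl
  LongPathIndex-irrelevant at-t5vv (at-t1vv _ p) = ⊥-elim (<-irrefl refl (≤-trans (n≤1+n _) p))
  LongPathIndex-irrelevant at-t5vv at-t5vv = refl
  LongPathIndex-irrelevant at-t45v (at-t1vv _ p) = ⊥-elim (<-irrefl refl (≤-trans (n≤1+n _) (≤-trans (n≤1+n _) p)))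
  LongPathIndex-irrelevant at-t45v at-t45v = refl

  longPathTriangle : ∀ {j} → LongPathIndex k j → Tri k
  longPathTriangle (at-t1vv j p) = ⟨ t1vv j p ⟩
  longPathTriangle at-tvvv = ⟨ tvvv ⟩
  longPathTriangle at-t5vv = ⟨ t5vv ⟩
  longPathTriangle at-t45v = ⟨ t45v ⟩

  LongPathIndex⇒<4+k : ∀ {j} → LongPathIndex k j → j < 4 + k
  LongPathIndex⇒<4+k (at-t1vv j p) = s≤s (≤-trans p (≤-trans (n≤1+n k) (≤-trans (n≤1+n _) (n≤1+n _))))
  LongPathIndex⇒<4+k at-tvvv = s≤s (s≤s (≤-trans (n≤1+n k) (n≤1+n _)))
  LongPathIndex⇒<4+k at-t5vv = s≤s (s≤s (s≤s (n≤1+n k)))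
  LongPathIndex⇒<4+k at-t45v = ≤-refl

  toTri : Θ k → Tri k
  toTri endS             = ⟨ t012 ⟩
  toTri endT             = ⟨ t045 ⟩
  toTri (in₁ zero)       = ⟨ t016 ⟩
  toTri (in₁ (suc zero)) = ⟨ t056 ⟩
  toTri (in₂ zero)       = ⟨ t023 ⟩
  toTri (in₂ (suc zero)) = ⟨ t034 ⟩
  toTri (in₃ zero)       = ⟨ t127 ⟩
  toTri (in₃ (suc i))    = longPathTriangle (longPathIndex (toℕ i) (toℕ<n i))

  fromTri : Tri k → Θ k
  fromTri ⟨ t012 ⟩ = endS
  fromTri ⟨ t045 ⟩ = endT
  fromTri ⟨ t016 ⟩ = in₁ zero
  fromTri ⟨ t056 ⟩ = in₁ (suc zero)
  fromTri ⟨ t023 ⟩ = in₂ zero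
  fromTri ⟨ t034 ⟩ = in₂ (suc zero)
  fromTri ⟨ t127 ⟩ = in₃ zero
  fromTri ⟨ t1vv j p ⟩ = in₃ (suc (fromℕ< (LongPathIndex⇒<4+k (at-t1vv j p))))
  fromTri ⟨ tvvv ⟩ = in₃ (suc (fromℕ< (LongPathIndex⇒<4+k at-tvvv)))
  fromTri ⟨ t5vv ⟩ = in₃ (suc (fromℕ< (LongPathIndex⇒<4+k at-t5vv)))
  fromTri ⟨ t45v ⟩ = in₃ (suc (fromℕ< (LongPathIndex⇒<4+k at-t45v)))

  private
    fromTri-longPathTriangle : ∀ {j} (p : LongPathIndex k j) →
                               fromTri (longPathTriangle p) ≡ in₃ (suc (fromℕ< (LongPathIndex⇒<4+k p)))
    fromTri-longPathTriangle (at-t1vv _ _) = refl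
    fromTri-longPathTriangle at-tvvv = refl
    fromTri-longPathTriangle at-t5vv = refl
    fromTri-longPathTriangle at-t45v = refl

    longPathTriangle-cong : ∀ {j j′} (p : LongPathIndex k j) (q : LongPathIndex k j′) → j ≡ j′ →
                            longPathTriangle p ≡ longPathTriangle q
    longPathTriangle-cong p q refl = cong longPathTriangle (LongPathIndex-irrelevant p q)

    toTri-fromTri-longPath : ∀ {j} (p : LongPathIndex k j) → toTri (in₃ (suc (fromℕ< (LongPathIndex⇒<4+k p)))) ≡ longPathTriangle p
    toTri-fromTri-longPath p = longPathTriangle-cong _ p (toℕ-fromℕ< (LongPathIndex⇒<4+k p))

  toTri-fromTri : ∀ s → toTri (fromTri s) ≡ s
  toTri-fromTri ⟨ t012 ⟩ = refl
  toTri-fromTri ⟨ t045 ⟩ = refl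
  toTri-fromTri ⟨ t016 ⟩ = refl
  toTri-fromTri ⟨ t056 ⟩ = refl
  toTri-fromTri ⟨ t023 ⟩ = refl
  toTri-fromTri ⟨ t034 ⟩ = refl
  toTri-fromTri ⟨ t127 ⟩ = refl
  toTri-fromTri ⟨ t1vv j p ⟩ = toTri-fromTri-longPath (at-t1vv j p)
  toTri-fromTri ⟨ tvvv ⟩ = toTri-fromTri-longPath at-tvvv
  toTri-fromTri ⟨ t5vv ⟩ = toTri-fromTri-longPath at-t5vv
  toTri-fromTri ⟨ t45v ⟩ = toTri-fromTri-longPath at-t45v

  fromTri-toTri : ∀ x → fromTri (toTri x) ≡ x
  fromTri-toTri endS             = refl
  fromTri-toTri endT             = refl
  fromTri-toTri (in₁ zero)       = refl
  fromTri-toTri (in₁ (suc zero)) = refl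
  fromTri-toTri (in₂ zero)       = refl
  fromTri-toTri (in₂ (suc zero)) = refl
  fromTri-toTri (in₃ zero)       = refl
  fromTri-toTri (in₃ (suc i))    = trans (fromTri-longPathTriangle p)
    (cong (λ i → in₃ (suc i)) (toℕ-injective (toℕ-fromℕ< (LongPathIndex⇒<4+k p))))
    where p = longPathIndex (toℕ i) (toℕ<n i)

  private
    longPath-next : ∀ {j} (p : LongPathIndex k j) (q : LongPathIndex k (suc j)) →
                    Next k (longPathTriangle p) (longPathTriangle q)
    longPath-next (at-t1vv j p) (at-t1vv _ q) = t1vv→t1vv j p q
    longPath-next (at-t1vv j p) at-tvvv = t1vv→tvvv p
    longPath-next (at-t1vv j p) at-t5vv = ⊥-elim (<-irrefl refl p)
    longPath-next (at-t1vv j p) at-t45v = ⊥-elim (<-irrefl refl (≤-trans (n≤1+n _) p))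
    longPath-next at-tvvv (at-t1vv _ q) = ⊥-elim (<-irrefl refl (≤-trans (n≤1+n _) q))
    longPath-next at-tvvv at-t5vv = tvvv→t5vv
    longPath-next at-t5vv (at-t1vv _ q) = ⊥-elim (<-irrefl refl (≤-trans (n≤1+n _) (≤-trans (n≤1+n _) q)))
    longPath-next at-t5vv at-t45v = t5vv→t45v
    longPath-next at-t45v (at-t1vv _ q) = ⊥-elim (<-irrefl refl (≤-trans (n≤1+n _) (≤-trans (n≤1+n _) (≤-trans (n≤1+n _) q))))

    longPath-next-≡ : ∀ {j j′} (p : LongPathIndex k j) (q : LongPathIndex k j′) → suc j ≡ j′ →
                      Next k (longPathTriangle p) (longPathTriangle q)
    longPath-next-≡ p q refl = longPath-next p q

  OnPath-successor⇒Next : ∀ {r p q} {x y : Θ k} → OnPath 3 3 (6 + k) r x p → OnPath 3 3 (6 + k) r y q →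
                          suc p ≡ q → Next k (toTri x) (toTri y)
  OnPath-successor⇒Next s₁ (i₁ zero) refl = t012→t016
  OnPath-successor⇒Next (i₁ zero) (i₁ (suc zero)) refl = t016→t056
  OnPath-successor⇒Next (i₁ (suc zero)) t₁ refl = t056→t045
  OnPath-successor⇒Next s₂ (i₂ zero) refl = t012→t023
  OnPath-successor⇒Next (i₂ zero) (i₂ (suc zero)) refl = t023→t034
  OnPath-successor⇒Next (i₂ (suc zero)) t₂ refl = t034→t045
  OnPath-successor⇒Next s₃ (i₃ zero) refl = t012→t127
  OnPath-successor⇒Next (i₃ zero) (i₃ (suc zero)) refl = t127→t1vv z≤n
  OnPath-successor⇒Next (i₃ (suc i)) (i₃ (suc i′)) e = longPath-next-≡ _ _ (suc-injective (suc-injective e))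
  OnPath-successor⇒Next (i₃ (suc i)) t₃ e =
    subst (λ s → Next k s ⟨ t045 ⟩) (longPathTriangle-cong at-t45v _ (sym (suc-injective (suc-injective (suc-injective e))))) t45v→t045
  OnPath-successor⇒Next t₃ (i₃ i) e =
    ⊥-elim (<-irrefl refl (≤-trans (n≤1+n _) (subst (_< 5 + k) (sym (suc-injective e)) (toℕ<n i))))

  ThetaAdj⇒Consecutive : ∀ {x y : Θ k} → ThetaAdj 3 3 (6 + k) x y → Consecutive k (toTri x) (toTri y)
  ThetaAdj⇒Consecutive (_ , _ , _ , x-at , y-at , inj₁ e) = inj₁ (OnPath-successor⇒Next x-at y-at e)
  ThetaAdj⇒Consecutive (_ , _ , _ , x-at , y-at , inj₂ e) = inj₂ (OnPath-successor⇒Next y-at x-at e)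

  private
    ThetaAdj-sym : ∀ {x y : Θ k} → ThetaAdj 3 3 (6 + k) x y → ThetaAdj 3 3 (6 + k) y x
    ThetaAdj-sym (r , p , q , x-at , y-at , e) = r , q , p , y-at , x-at , swap e

    longPath-adjacent : ∀ {j} (p : LongPathIndex k j) (q : LongPathIndex k (suc j)) →
                        ThetaAdj 3 3 (6 + k) (fromTri (longPathTriangle p)) (fromTri (longPathTriangle q))
    longPath-adjacent p q rewrite fromTri-longPathTriangle p | fromTri-longPathTriangle q =
      3 , _ , _ , i₃ (suc _) , i₃ (suc _) ,
      inj₁ (cong (λ n → 2 + n) (trans (cong suc (toℕ-fromℕ< (LongPathIndex⇒<4+k p))) (sym (toℕ-fromℕ< (LongPathIndex⇒<4+k q)))))

  Next⇒ThetaAdj : ∀ {s t : Tri k} → Next k s t → ThetaAdj 3 3 (6 + k) (fromTri s) (fromTri t)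
  Next⇒ThetaAdj t012→t016 = 1 , _ , _ , s₁ , i₁ zero , inj₁ refl
  Next⇒ThetaAdj t016→t056 = 1 , _ , _ , i₁ zero , i₁ (suc zero) , inj₁ refl
  Next⇒ThetaAdj t056→t045 = 1 , _ , _ , i₁ (suc zero) , t₁ , inj₁ refl
  Next⇒ThetaAdj t012→t023 = 2 , _ , _ , s₂ , i₂ zero , inj₁ refl
  Next⇒ThetaAdj t023→t034 = 2 , _ , _ , i₂ zero , i₂ (suc zero) , inj₁ refl
  Next⇒ThetaAdj t034→t045 = 2 , _ , _ , i₂ (suc zero) , t₂ , inj₁ refl
  Next⇒ThetaAdj t012→t127 = 3 , _ , _ , s₃ , i₃ zero , inj₁ refl
  Next⇒ThetaAdj (t127→t1vv _) = 3 , _ , _ , i₃ zero , i₃ (suc _) , inj₁ refl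
  Next⇒ThetaAdj (t1vv→t1vv j p q) = longPath-adjacent (at-t1vv j p) (at-t1vv (suc j) q)
  Next⇒ThetaAdj (t1vv→tvvv p) = longPath-adjacent (at-t1vv k p) at-tvvv
  Next⇒ThetaAdj tvvv→t5vv = longPath-adjacent at-tvvv at-t5vv
  Next⇒ThetaAdj t5vv→t45v = longPath-adjacent at-t5vv at-t45v
  Next⇒ThetaAdj t45v→t045 =
    3 , _ , _ , i₃ (suc _) , t₃ , inj₁ (cong (λ n → 3 + n) (toℕ-fromℕ< (LongPathIndex⇒<4+k at-t45v)))

  Consecutive⇒ThetaAdj : ∀ {x y : Θ k} → Consecutive k (toTri x) (toTri y) → ThetaAdj 3 3 (6 + k) x y
  Consecutive⇒ThetaAdj {x} {y} (inj₁ next) =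
    subst₂ (ThetaAdj 3 3 (6 + k)) (fromTri-toTri x) (fromTri-toTri y) (Next⇒ThetaAdj next)
  Consecutive⇒ThetaAdj {x} {y} (inj₂ next) =
    subst₂ (ThetaAdj 3 3 (6 + k)) (fromTri-toTri x) (fromTri-toTri y) (ThetaAdj-sym (Next⇒ThetaAdj next))

  ThetaAdj⇔Consecutive : ∀ {x y : Θ k} → ThetaAdj 3 3 (6 + k) x y ⇔ Consecutive k (toTri x) (toTri y)
  ThetaAdj⇔Consecutive = mk⇔ ThetaAdj⇒Consecutive Consecutive⇒ThetaAdj

mainTheorem20 : (ℓ : ℕ) → 6 ≤ ℓ →
    ((S : Subset (ℓ + 4)) → IsISet (GAdj ℓ) S ⇔ IsAlphaSet (GAdj ℓ) S)
    × IGraphIso (GAdj ℓ) (ThetaV 3 3 ℓ) (ThetaAdj 3 3 ℓ)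
mainTheorem20 (suc (suc (suc (suc (suc (suc k)))))) (s≤s (s≤s (s≤s (s≤s (s≤s (s≤s z≤n)))))) =
  (λ S → mk⇔ iSet⇒alphaSet (alphaSet⇒iSet (alphaSet⇒dominating G? G-sym G-irrefl))) ,
  record
    { f      = λ x → triangleSet (toTri x)
    ; f-iset = λ x → indepDominating⇒iSet (triangleSet-independent (toTri x) , triangleSet-dominating (toTri x))
    ; f-inj  = λ x y eq → trans (sym (fromTri-toTri x)) (trans (cong fromTri (triangleSet-injective eq)) (fromTri-toTri y))
    ; f-surj = λ S (S-id , _) → case indepDominating⇒triangleSet S-id of λ
        { (s , s≡S) → fromTri s , trans (cong triangleSet (toTri-fromTri s)) s≡S }
    ; f-adj  = λ x y → ⇔-trans ThetaAdj⇔Consecutive (⇔-trans (⇔-sym SharesEdge⇔Consecutive) (⇔-sym slide⇔SharesEdge))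
    }
  where
  open Sandwiched {Adj = G k} 3 (λ T (indep , dom) → Distinct3⇒3≤∣S∣ (indepDominating⇒Distinct3 indep dom))
                                (λ T → independent⇒∣S∣≤3)
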